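{- Let $G$ be a connected graph, $k\ge 1$ an integer, and $X\subseteq V(G)$ a twin cover of $G$ with $t:=|X|$. Let $S\subseteq X$ and $s\in\{1,\dots,k\}$ be such that $|\mathcal{C}_{S,s}|>(t+1)\binom{k}{s}$, and let $C\in\mathcal{C}_{S,s}$. Then $G-C$ is connected, $X$ is a twin cover of $G-C$, and $\operatorname{svcfc}(G)\le k$ if and only if $\operatorname{svcfc}(G-C)\le k$.
   Context: All graphs are finite, simple and undirected. For a vertex coloring $c\colon V(G)\to\mathbb{N}$, a path is conflict-free if some color appears on exactly one of its vertices. A coloring of a connected graph $G$ is a strong CFVC coloring if every two distinct vertices $u,v$ are joined by a conflict-free shortest $u$-$v$ path. $\operatorname{svcfc}(G)$ is the minimum number of colors of a strong CFVC coloring of $G$. Vertices $u\neq v$ are true twins if $N_G[u]=N_G[v]$; a twin edge is an edge whose endpoints are true twins; $X\subseteq V(G)$ is a twin cover if every edge of $G-X$ is a twin edge. A twin-clique is a connected component of $G-X$; its vertices all have the same neighborhood in $X$, denoted $N_X(C)$. $\mathcal{C}_{S,s}$ is the set of twin-cliques $C$ with $N_X(C)=S$ and $|C|=s$. -}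

module Defs where

open import Data.Nat using (ℕ; suc; _≤_)
open import Data.Bool using (Bool; true; false)
open import Data.Fin using (Fin; _≟_)
open import Data.Fin.Subset using (Subset; _∈_; _∉_; _⊆_; _─_; ∣_∣; Nonempty)
open import Data.List using (List; []; _∷_; length; filter)
open import Data.List.Relation.Unary.Unique.Propositional using (Unique)
open import Data.Product using (Σ; ∃; _×_; _,_)
open import Data.Sum using (_⊎_)
open import Relation.Binary.PropositionalEquality using (_≡_; _≢_)
open import Function.Bundles using (_⇔_)

record Graph (n : ℕ) : Set where
  field
    adj     : Fin n → Fin n → Bool
    adj-sym : ∀ u v → adj u v ≡ adj v u
    irrefl  : ∀ u → adj u u ≡ false
open Graph public

module _ {n : ℕ} (G : Graph n) where

  Adj : Fin n → Fin n → Set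
  Adj u v = adj G u v ≡ true

  -- All notions below are relative to the induced subgraph G[W] for a
  -- vertex set W ⊆ V(G).  G itself is G[⊤] and G - C is G[⊤ ─ C].

  data Walk (W : Subset n) : Fin n → Fin n → List (Fin n) → Set where
    single : ∀ {u} → u ∈ W → Walk W u u (u ∷ [])
    step   : ∀ {u w v p} → u ∈ W → Adj u w → Walk W w v p → Walk W u v (u ∷ p)

  IsPath : Subset n → Fin n → Fin n → List (Fin n) → Set
  IsPath W u v p = Walk W u v p × Unique p

  IsShortestPath : Subset n → Fin n → Fin n → List (Fin n) → Set
  IsShortestPath W u v p =
    IsPath W u v p × (∀ q → IsPath W u v q → length p ≤ length q)

  Connected : Subset n → Set
  Connected W = ∀ u v → u ∈ W → v ∈ W → ∃ λ p → IsPath W u v p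

  TrueTwins : Subset n → Fin n → Fin n → Set
  TrueTwins W u v =
    u ≢ v × (∀ w → w ∈ W → ((w ≡ u ⊎ Adj w u) ⇔ (w ≡ v ⊎ Adj w v)))

  TwinCover : Subset n → Subset n → Set
  TwinCover W X =
    X ⊆ W × (∀ u v → u ∈ (W ─ X) → v ∈ (W ─ X) → Adj u v → TrueTwins W u v)

  -- C is a connected component of G[W] - X (a twin-clique).
  IsTwinClique : Subset n → Subset n → Subset n → Set
  IsTwinClique W X C =
    C ⊆ (W ─ X)
    × Nonempty C
    × (∀ u v → u ∈ C → v ∈ C → ∃ λ p → IsPath C u v p)
    × (∀ u w → u ∈ C → w ∈ (W ─ X) → Adj u w → w ∈ C)

  NXis : Subset n → Subset n → Subset n → Set
  NXis X C S = ∀ x → (x ∈ S ⇔ (x ∈ X × ∃ λ c → c ∈ C × Adj c x))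

  InCSs : Subset n → Subset n → Subset n → ℕ → Subset n → Set
  InCSs W X S s C = IsTwinClique W X C × NXis X C S × ∣ C ∣ ≡ s

  ConflictFree : {k : ℕ} → (Fin n → Fin k) → List (Fin n) → Set
  ConflictFree {k} c p = ∃ λ (i : Fin k) → length (filter (λ x → c x ≟ i) p) ≡ 1

  StrongCFVC : {k : ℕ} → Subset n → (Fin n → Fin k) → Set
  StrongCFVC W c = ∀ u v → u ∈ W → v ∈ W → u ≢ v →
    ∃ λ p → IsShortestPath W u v p × ConflictFree c p

  svcfc≤ : Subset n → ℕ → Set
  svcfc≤ W k = ∃ λ (c : Fin n → Fin k) → StrongCFVC W c

-- Every vertex of a twin-clique in 𝒞_{S,s} has closed neighbourhood (its clique) ∪ S. Hence
-- the members of 𝒞_{S,s} are interchanged by automorphisms of G, and contracting C onto a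
-- vertex of another member maps walks of G to walks of G − C that are not longer: G − C stays
-- connected and distances between vertices outside C do not change.
--
-- (⇐) Colour C like another member D each of whose vertices sees a differently coloured vertex
-- of S; of any two members at least one has this property.
--
-- (⇒) In a strong colouring of G each member carries an s-set of colours, so by pigeonhole
-- |X| + 2 members C′, D₁, …, D_{|X|+1} share one colour set. No two consecutive vertices of a
-- shortest path lie outside X (true twins would shortcut it), so a shortest path meets at most
-- |X| + 1 twin-cliques. A shortest path through C′ thus misses some Dᵢ, and moving its C′-vertices
-- to the equally coloured vertices of Dᵢ keeps it shortest and conflict-free in G − C′.
-- Finally G − C′ ≅ G − C.

module Submission where

open import Defs
open import Data.Nat using (ℕ; zero; suc; _+_; _*_; _≤_; _<_; z≤n; s≤s; _<?_)
open import Data.Nat.Properties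
  using (≤-refl; ≤-trans; ≤-reflexive; <-irrefl; <⇒≱; ≮⇒≥; n≮0; m≤n⇒m≤1+n; m≤n+m; +-suc; +-comm; *-suc;
         +-monoˡ-≤; +-cancelˡ-<; *-identityʳ; *-monoʳ-≤; suc-injective; module ≤-Reasoning)
import Data.Bool.Properties as Bool
open import Data.Empty using (⊥)
open import Data.Fin using (Fin; zero; suc; _≟_)
import Data.Fin.Properties as Fin
open import Data.Fin.Subset
  using (Subset; _∈_; _∉_; _⊆_; _∪_; _─_; _-_; ⁅_⁆; ⊤; ∣_∣; inside; outside; Nonempty) renaming (⊥ to ∅)
open import Data.Fin.Subset.Properties
  using (_∈?_; ∈⊤; ∉⊥; ∣⊥∣≡0; x∈⁅x⁆; x∈⁅y⁆⇒x≡y; x∈p∪q⁻; x∈p∪q⁺; ∪-identityˡ; p─⊥≡p; p─q⊆p; x∈p∧x∉q⇒x∈p─q;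
         x∈p∧x≢y⇒x∈p-y; x∈p⇒∣p-x∣<∣p∣; nonempty?; Empty-unique; ⊆-antisym)
open import Data.Vec using ([]; _∷_)
open import Data.Vec.Base using () renaming (here to vhere; there to vthere)
open import Data.Vec.Properties using (≡-dec)
open import Data.List using (List; []; _∷_; length; filter; map; reverse; _++_; _∷ʳ_)
open import Data.List.Properties
  using (length-++; length-map; length-reverse; unfold-reverse; map-∘; map-cong; filter-accept; filter-reject;
         filter-all; filter-none)
open import Data.List.Membership.Propositional using (find; lose) renaming (_∈_ to _∈ₗ_; _∉_ to _∉ₗ_)
open import Data.List.Membership.Propositional.Properties
  using (∈-∃++; ∈-++⁺ˡ; ∈-++⁺ʳ; ∈-map⁺; ∈-map⁻; ∈-filter⁺; ∈-filter⁻; ∈-length)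
open import Data.List.Relation.Binary.Subset.Propositional using () renaming (_⊆_ to _⊆ₗ_)
open import Data.List.Relation.Binary.Permutation.Propositional using (↭-sym; ↭⇒↭ₛ)
open import Data.List.Relation.Binary.Permutation.Propositional.Properties using (↭-reverse; ↭-length; filter-↭)
import Data.List.Relation.Binary.Permutation.Setoid.Properties as Permutationₛ
import Data.List.Relation.Binary.Sublist.Propositional.Properties as Sublist
open import Data.List.Relation.Unary.All as All using (All; []; _∷_; all?)
open import Data.List.Relation.Unary.All.Properties using (¬Any⇒All¬; ¬All⇒Any¬; all-filter)
open import Data.List.Relation.Unary.Any using (Any; here; there; any?)
import Data.List.Relation.Unary.Any.Properties as Anyₚ
open import Data.List.Relation.Unary.AllPairs as AllPairs using ([]; _∷_)
open import Data.List.Relation.Unary.Unique.Propositional using (Unique)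
open import Data.List.Relation.Unary.Unique.Propositional.Properties using (filter⁺)
open import Data.Product using (∃; ∃₂; _×_; _,_; proj₁; proj₂)
open import Data.Sum using (_⊎_; inj₁; inj₂; [_,_])
open import Function using (_∘_; id; case_of_)
open import Function.Bundles using (_⇔_; mk⇔; Equivalence)
open Equivalence using (to; from)
open import Level using (Level; _⊔_)
open import Relation.Nullary using (¬_; Dec; yes; no; ¬?; _×-dec_; contradiction)
open import Relation.Unary using (Pred; Decidable; ∁)
open import Relation.Unary.Properties using (∁?)
open import Relation.Binary.Definitions using (DecidableEquality)
open import Relation.Binary.PropositionalEquality
  using (_≡_; _≢_; refl; sym; trans; cong; cong₂; subst; subst₂; setoid; module ≡-Reasoning)

-- Lists

module _ {a} {A : Set a} where

  unique-∷ : ∀ {x : A} {xs} → x ∉ₗ xs → Unique xs → Unique (x ∷ xs)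
  unique-∷ x∉xs u = ¬Any⇒All¬ _ x∉xs ∷ u

  unique-reverse : ∀ {xs : List A} → Unique xs → Unique (reverse xs)
  unique-reverse {xs} = Permutationₛ.Unique-resp-↭ (setoid A) (↭⇒↭ₛ (↭-sym (↭-reverse xs)))

  hitting-length-≤ : ∀ {b r} {B : Set b} (R : A → B → Set r) {xs : List A} {ys : List B} → Unique xs →
    (∀ {x x′ y} → x ∈ₗ xs → x′ ∈ₗ xs → R x y → R x′ y → x ≡ x′) → All (λ x → Any (R x) ys) xs →
    length xs ≤ length ys
  hitting-length-≤ R {[]} _ _ _ = z≤n
  hitting-length-≤ R {x ∷ xs} (x∉xs ∷ u) shared (x-hits ∷ xs-hit)
    with y , y∈ys , Rxy ← find x-hits
    with ys₁ , ys₂ , refl ← ∈-∃++ y∈ys = begin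
    suc (length xs)                 ≤⟨ s≤s (hitting-length-≤ R u (λ x∈ x′∈ → shared (there x∈) (there x′∈)) xs-hit′) ⟩
    suc (length (ys₁ ++ ys₂))       ≡⟨ cong suc (length-++ ys₁) ⟩
    suc (length ys₁ + length ys₂)   ≡⟨ +-suc (length ys₁) (length ys₂) ⟨
    length ys₁ + length (y ∷ ys₂)   ≡⟨ length-++ ys₁ ⟨
    length (ys₁ ++ y ∷ ys₂)         ∎
    where
    open ≤-Reasoning
    xs-hit′ : All (λ x′ → Any (R x′) (ys₁ ++ ys₂)) xs
    xs-hit′ = All.tabulate λ {x′} x′∈xs → case Anyₚ.++⁻ ys₁ (All.lookup xs-hit x′∈xs) of λ where
      (inj₁ hit₁) → Anyₚ.++⁺ˡ hit₁
      (inj₂ (here Rx′y)) → contradiction (shared (here refl) (there x′∈xs) Rxy Rx′y) (All.lookup x∉xs x′∈xs)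
      (inj₂ (there hit₂)) → Anyₚ.++⁺ʳ ys₁ hit₂

  unique-length-≤ : ∀ {xs ys : List A} → Unique xs → xs ⊆ₗ ys → length xs ≤ length ys
  unique-length-≤ u xs⊆ys = hitting-length-≤ _≡_ u (λ _ _ x≡y x′≡y → trans x≡y (sym x′≡y)) (All.tabulate xs⊆ys)

  module _ {p} {P : Pred A p} (P? : Decidable P) where

    length-filter-∁ : ∀ xs → length (filter P? xs) + length (filter (∁? P?) xs) ≡ length xs
    length-filter-∁ [] = refl
    length-filter-∁ (x ∷ xs) with P? x
    ... | yes _ = cong suc (length-filter-∁ xs)
    ... | no _ = trans (+-suc (length (filter P? xs)) _) (cong suc (length-filter-∁ xs))

module _ {a b} {A : Set a} {B : Set b} {f : A → B} where

  unique-map⁺ : ∀ {xs} → (∀ {x y} → x ∈ₗ xs → y ∈ₗ xs → f x ≡ f y → x ≡ y) →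
                Unique xs → Unique (map f xs)
  unique-map⁺ {[]} _ _ = []
  unique-map⁺ {x ∷ xs} inj (x∉xs ∷ u) =
    unique-∷ fx∉ (unique-map⁺ (λ x∈ y∈ → inj (there x∈) (there y∈)) u)
    where
    fx∉ : f x ∉ₗ map f xs
    fx∉ fx∈ with y , y∈xs , fx≡fy ← ∈-map⁻ f fx∈ = All.lookup x∉xs y∈xs (inj (here refl) (there y∈xs) fx≡fy)

m*n<l⇒m<l : ∀ {m n l} → 0 < n → m * n < l → m < l
m*n<l⇒m<l {m} {n} 0<n m*n<l = ≤-trans (s≤s (subst (_≤ m * n) (*-identityʳ m) (*-monoʳ-≤ m 0<n))) m*n<l

module _ {a b} {A : Set a} {B : Set b} (_≟_ : DecidableEquality B) (f : A → B) where

  pigeonhole : ∀ t (V : List B) (L : List A) → All (λ x → f x ∈ₗ V) L → t * length V < length L →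
               ∃ λ v → t < length (filter (λ x → f x ≟ v) L)
  pigeonhole t [] [] _ big = contradiction big n≮0
  pigeonhole t [] (x ∷ L) (() ∷ _) _
  pigeonhole t (v ∷ V) L L⊆V big with t <? length (filter (λ x → f x ≟ v) L)
  ... | yes many = v , many
  ... | no few with pigeonhole t V rest rest⊆V (+-cancelˡ-< t _ _ bound)
    where
    rest : List A
    rest = filter (λ x → ¬? (f x ≟ v)) L
    rest⊆V : All (λ x → f x ∈ₗ V) rest
    rest⊆V = All.tabulate λ x∈rest → let (x∈L , fx≢v) = ∈-filter⁻ (λ x → ¬? (f x ≟ v)) x∈rest in
      drop-v (All.lookup L⊆V x∈L) fx≢v
      where
      drop-v : ∀ {y} → y ∈ₗ v ∷ V → ¬ y ≡ v → y ∈ₗ V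
      drop-v (here y≡v) y≢v = contradiction y≡v y≢v
      drop-v (there y∈V) _ = y∈V
    bound : t + t * length V < t + length rest
    bound = begin-strict
      t + t * length V                                   ≡⟨ *-suc t (length V) ⟨
      t * suc (length V)                                 <⟨ big ⟩
      length L                                           ≡⟨ length-filter-∁ (λ x → f x ≟ v) L ⟨
      length (filter (λ x → f x ≟ v) L) + length rest    ≤⟨ +-monoˡ-≤ (length rest) (≮⇒≥ few) ⟩
      t + length rest                                    ∎
      where open ≤-Reasoning
  ... | w , many = w , ≤-trans many (Sublist.length-mono-≤
    (Sublist.filter⁺ (λ x → f x ≟ w) (λ x → f x ≟ w) (λ { refl p → p }) (Sublist.filter-⊆ (λ x → ¬? (f x ≟ v)) L)))

module _ {a b p} {A : Set a} {B : Set b} {P : Pred B p} (P? : Decidable P) where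

  length-filter-map : ∀ (f : A → B) xs → length (filter (P? ∘ f) xs) ≡ length (filter P? (map f xs))
  length-filter-map f [] = refl
  length-filter-map f (x ∷ xs) with P? (f x)
  ... | yes _ = cong suc (length-filter-map f xs)
  ... | no _ = length-filter-map f xs

module _ {k : ℕ} where

  OccursOnce : List (Fin k) → Set
  OccursOnce cs = ∃ λ i → length (filter (_≟ i) cs) ≡ 1

  once-pair : ∀ {i j : Fin k} → i ≢ j → OccursOnce (i ∷ j ∷ [])
  once-pair {i} {j} i≢j =
    i , cong length (trans (filter-accept (_≟ i) refl) (cong (i ∷_) (filter-reject (_≟ i) (i≢j ∘ sym))))

  ¬once-pair : ∀ {i : Fin k} → ¬ OccursOnce (i ∷ i ∷ [])
  ¬once-pair {i} (j , once) = by-cases (i ≟ j)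
    where
    by-cases : Dec (i ≡ j) → ⊥
    by-cases (yes i≡j) with () ← trans (sym (cong length (filter-all (_≟ j) (i≡j ∷ i≡j ∷ [])))) once
    by-cases (no i≢j) with () ← trans (sym (cong length (filter-none (_≟ j) (i≢j ∷ i≢j ∷ [])))) once

  once-triple : ∀ {i j l : Fin k} → ¬ (i ≡ j × j ≡ l) → OccursOnce (i ∷ j ∷ l ∷ [])
  once-triple {i} {j} {l} not-constant with j ≟ i | l ≟ i
  ... | yes refl | yes refl = contradiction (refl , refl) not-constant
  ... | yes refl | no l≢i = l , cong length
    (trans (filter-reject (_≟ l) (l≢i ∘ sym)) (trans (filter-reject (_≟ l) (l≢i ∘ sym)) (filter-accept (_≟ l) refl)))
  ... | no j≢i | yes refl = j , cong length
    (trans (filter-reject (_≟ j) (j≢i ∘ sym))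
      (trans (filter-accept (_≟ j) refl) (cong (j ∷_) (filter-reject (_≟ j) (j≢i ∘ sym)))))
  ... | no j≢i | no l≢i = i , cong length
    (trans (filter-accept (_≟ i) refl) (cong (i ∷_) (trans (filter-reject (_≟ i) j≢i) (filter-reject (_≟ i) l≢i))))

  ¬once-triple : ∀ {i : Fin k} → ¬ OccursOnce (i ∷ i ∷ i ∷ [])
  ¬once-triple {i} (j , once) = by-cases (i ≟ j)
    where
    by-cases : Dec (i ≡ j) → ⊥
    by-cases (yes i≡j) with () ← trans (sym (cong length (filter-all (_≟ j) (i≡j ∷ i≡j ∷ i≡j ∷ [])))) once
    by-cases (no i≢j) with () ← trans (sym (cong length (filter-none (_≟ j) (i≢j ∷ i≢j ∷ i≢j ∷ [])))) once

involutive⇒injective : ∀ {a} {A : Set a} {f : A → A} → (∀ x → f (f x) ≡ x) → ∀ {x y} → f x ≡ f y → x ≡ y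
involutive⇒injective {f = f} involutive {x} {y} fx≡fy =
  trans (sym (involutive x)) (trans (cong f fx≡fy) (involutive y))

module _ {a p : Level} {A : Set a} where

  data Consecutive (P : Pred A p) : List A → Set (a ⊔ p) where
    here : ∀ {x y xs} → P x → P y → Consecutive P (x ∷ y ∷ xs)
    there : ∀ {x xs} → Consecutive P xs → Consecutive P (x ∷ xs)

  module _ {P : Pred A p} (P? : Decidable P) where

    ¬Consecutive⇒length-filter-∁ : ∀ xs → ¬ Consecutive (∁ P) xs →
                                    length (filter (∁? P?) xs) ≤ suc (length (filter P? xs))
    ¬Consecutive⇒length-filter-∁ [] _ = z≤n
    ¬Consecutive⇒length-filter-∁ (x ∷ xs) ¬c with P? x
    ... | yes _ = m≤n⇒m≤1+n (¬Consecutive⇒length-filter-∁ xs (λ c → ¬c (there c)))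
    ¬Consecutive⇒length-filter-∁ (x ∷ []) ¬c | no _ = s≤s z≤n
    ¬Consecutive⇒length-filter-∁ (x ∷ y ∷ xs) ¬c | no ¬px with P? y
    ... | yes _ = s≤s (¬Consecutive⇒length-filter-∁ xs (λ c → ¬c (there (there c))))
    ... | no ¬py = contradiction (here ¬px ¬py) ¬c

module _ {a} {A : Set a} (_≟_ : DecidableEquality A) where

  unique⇒other : ∀ {xs} (x : A) → Unique xs → 2 ≤ length xs → ∃ λ y → y ∈ₗ xs × y ≢ x
  unique⇒other {_ ∷ []} _ _ (s≤s ())
  unique⇒other {y ∷ z ∷ _} x ((y≢z ∷ _) ∷ _) _ with y ≟ x
  ... | yes refl = z , there (here refl) , y≢z ∘ sym
  ... | no y≢x = y , here refl , y≢x

  unique⇒two-others : ∀ {xs} (x : A) → Unique xs → 3 ≤ length xs →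
                      ∃₂ λ y z → y ∈ₗ xs × z ∈ₗ xs × y ≢ x × z ≢ x × y ≢ z
  unique⇒two-others {_ ∷ []} _ _ (s≤s ())
  unique⇒two-others {_ ∷ _ ∷ []} _ _ (s≤s (s≤s ()))
  unique⇒two-others {y ∷ z ∷ w ∷ _} x ((y≢z ∷ y≢w ∷ _) ∷ (z≢w ∷ _) ∷ _) _ with y ≟ x | z ≟ x
  ... | yes refl | _ = z , w , there (here refl) , there (there (here refl)) , y≢z ∘ sym , y≢w ∘ sym , z≢w
  ... | no y≢x | yes refl = y , w , here refl , there (there (here refl)) , y≢x , z≢w ∘ sym , y≢w
  ... | no y≢x | no z≢x = y , z , here refl , there (here refl) , y≢x , z≢x , y≢z

-- Subsets of Fin n

module _ where

  private variable
    n k : ℕ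
    x y : Fin n
    p q : Subset n

  x∈p─q⇒x∉q : x ∈ p ─ q → x ∉ q
  x∈p─q⇒x∉q {p = inside ∷ p} {outside ∷ q} vhere ()
  x∈p─q⇒x∉q {p = _ ∷ p} {_ ∷ q} (vthere x∈p─q) (vthere x∈q) = x∈p─q⇒x∉q x∈p─q x∈q

  _≟ₛ_ : DecidableEquality (Subset n)
  _≟ₛ_ = ≡-dec Bool._≟_

  ∉⇒∈⊤─ : x ∉ q → x ∈ ⊤ ─ q
  ∉⇒∈⊤─ = x∈p∧x∉q⇒x∈p─q ∈⊤

  suc∣p-x∣≡∣p∣ : x ∈ p → suc ∣ p - x ∣ ≡ ∣ p ∣
  suc∣p-x∣≡∣p∣ {x = zero} {p = inside ∷ p} vhere = cong (suc ∘ ∣_∣) (p─⊥≡p p)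
  suc∣p-x∣≡∣p∣ {x = suc x} {p = outside ∷ p} (vthere x∈p) = suc∣p-x∣≡∣p∣ x∈p
  suc∣p-x∣≡∣p∣ {x = suc x} {p = inside ∷ p} (vthere x∈p) = cong suc (suc∣p-x∣≡∣p∣ x∈p)

  ∣p∣≡0⇒x∉p : ∣ p ∣ ≡ 0 → x ∉ p
  ∣p∣≡0⇒x∉p ∣p∣≡0 x∈p with () ← trans (suc∣p-x∣≡∣p∣ x∈p) ∣p∣≡0

  ∣p∣≡suc⇒Nonempty : ∀ {n m} {p : Subset n} → ∣ p ∣ ≡ suc m → Nonempty p
  ∣p∣≡suc⇒Nonempty {n = n} {p = p} ∣p∣≡1+m with nonempty? p
  ... | yes ne = ne
  ... | no empty with () ← trans (sym ∣p∣≡1+m) (trans (cong ∣_∣ (Empty-unique empty)) (∣⊥∣≡0 n))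

  unique-length-≤-∣p∣ : ∀ {xs : List (Fin n)} → Unique xs → All (_∈ p) xs → length xs ≤ ∣ p ∣
  unique-length-≤-∣p∣ [] [] = z≤n
  unique-length-≤-∣p∣ {p = p} (x∉xs ∷ u) (x∈p ∷ xs⊆p) = ≤-trans
    (s≤s (unique-length-≤-∣p∣ u (All.zipWith (λ (y∈p , x≢y) → x∈p∧x≢y⇒x∈p-y y∈p (x≢y ∘ sym)) (xs⊆p , x∉xs))))
    (≤-reflexive (suc∣p-x∣≡∣p∣ x∈p))

  ∣⁅x⁆∪p∣≡suc∣p∣ : x ∉ p → ∣ ⁅ x ⁆ ∪ p ∣ ≡ suc ∣ p ∣
  ∣⁅x⁆∪p∣≡suc∣p∣ {x = zero} {p = outside ∷ p} _ = cong (suc ∘ ∣_∣) (∪-identityˡ p)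
  ∣⁅x⁆∪p∣≡suc∣p∣ {x = zero} {p = inside ∷ p} x∉p = contradiction vhere x∉p
  ∣⁅x⁆∪p∣≡suc∣p∣ {x = suc x} {p = outside ∷ p} x∉p = ∣⁅x⁆∪p∣≡suc∣p∣ (x∉p ∘ vthere)
  ∣⁅x⁆∪p∣≡suc∣p∣ {x = suc x} {p = inside ∷ p} x∉p = cong suc (∣⁅x⁆∪p∣≡suc∣p∣ (x∉p ∘ vthere))

  image : (Fin n → Fin k) → Subset n → Subset k
  image f [] = ∅
  image f (outside ∷ p) = image (f ∘ suc) p
  image f (inside ∷ p) = ⁅ f zero ⁆ ∪ image (f ∘ suc) p

  ∈-image⁺ : ∀ (f : Fin n → Fin k) → x ∈ p → f x ∈ image f p
  ∈-image⁺ {p = inside ∷ p} f vhere = x∈p∪q⁺ (inj₁ (x∈⁅x⁆ (f zero)))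
  ∈-image⁺ {p = outside ∷ p} f (vthere x∈p) = ∈-image⁺ (f ∘ suc) x∈p
  ∈-image⁺ {p = inside ∷ p} f (vthere x∈p) = x∈p∪q⁺ (inj₂ (∈-image⁺ (f ∘ suc) x∈p))

  ∈-image⁻ : ∀ (f : Fin n → Fin k) {y} → y ∈ image f p → ∃ λ x → x ∈ p × f x ≡ y
  ∈-image⁻ {p = []} f y∈ = contradiction y∈ ∉⊥
  ∈-image⁻ {p = outside ∷ p} f y∈ with ∈-image⁻ (f ∘ suc) y∈
  ... | x , x∈p , fx≡y = suc x , vthere x∈p , fx≡y
  ∈-image⁻ {p = inside ∷ p} f y∈ with x∈p∪q⁻ ⁅ f zero ⁆ _ y∈
  ... | inj₁ y∈⁅f0⁆ = zero , vhere , sym (x∈⁅y⁆⇒x≡y _ y∈⁅f0⁆)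
  ... | inj₂ y∈image with ∈-image⁻ (f ∘ suc) y∈image
  ...   | x , x∈p , fx≡y = suc x , vthere x∈p , fx≡y

  ∣image∣≡∣p∣ : ∀ (f : Fin n → Fin k) → (∀ {x y} → x ∈ p → y ∈ p → f x ≡ f y → x ≡ y) →
                ∣ image f p ∣ ≡ ∣ p ∣
  ∣image∣≡∣p∣ {k = k} {p = []} f _ = ∣⊥∣≡0 k
  ∣image∣≡∣p∣ {p = outside ∷ p} f inj =
    ∣image∣≡∣p∣ (f ∘ suc) λ x∈p y∈p fx≡fy → Fin.suc-injective (inj (vthere x∈p) (vthere y∈p) fx≡fy)
  ∣image∣≡∣p∣ {p = inside ∷ p} f inj = trans (∣⁅x⁆∪p∣≡suc∣p∣ f0∉image) (cong suc (∣image∣≡∣p∣ (f ∘ suc) inj′))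
    where
    inj′ : ∀ {x y} → x ∈ p → y ∈ p → f (suc x) ≡ f (suc y) → x ≡ y
    inj′ x∈p y∈p fx≡fy = Fin.suc-injective (inj (vthere x∈p) (vthere y∈p) fx≡fy)
    f0∉image : f zero ∉ image (f ∘ suc) p
    f0∉image f0∈ with x , x∈p , fx≡f0 ← ∈-image⁻ (f ∘ suc) f0∈ with () ← inj vhere (vthere x∈p) (sym fx≡f0)

  subsetsOfSize : (k s : ℕ) → List (Subset k)
  subsetsOfSize zero zero = [] ∷ []
  subsetsOfSize zero (suc s) = []
  subsetsOfSize (suc k) zero = map (outside ∷_) (subsetsOfSize k zero)
  subsetsOfSize (suc k) (suc s) = map (outside ∷_) (subsetsOfSize k (suc s)) ++ map (inside ∷_) (subsetsOfSize k s)

  ∈-subsetsOfSize : ∀ (p : Subset k) → p ∈ₗ subsetsOfSize k ∣ p ∣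
  ∈-subsetsOfSize [] = here refl
  ∈-subsetsOfSize (outside ∷ p) with ∣ p ∣ | ∈-subsetsOfSize p
  ... | zero | p∈ = ∈-map⁺ (outside ∷_) p∈
  ... | suc s | p∈ = ∈-++⁺ˡ (∈-map⁺ (outside ∷_) p∈)
  ∈-subsetsOfSize {suc k} (inside ∷ p) =
    ∈-++⁺ʳ (map (outside ∷_) (subsetsOfSize k (suc ∣ p ∣))) (∈-map⁺ (inside ∷_) (∈-subsetsOfSize p))

  subsetsOfSize-nonempty : ∀ {k s} → s ≤ k → 0 < length (subsetsOfSize k s)
  subsetsOfSize-nonempty {zero} {zero} _ = s≤s z≤n
  subsetsOfSize-nonempty {suc k} {zero} _ =
    subst (0 <_) (sym (length-map (outside ∷_) (subsetsOfSize k zero))) (subsetsOfSize-nonempty {k} {zero} z≤n)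
  subsetsOfSize-nonempty {suc k} {suc s} (s≤s s≤k) = begin-strict
    0                                                   <⟨ subsetsOfSize-nonempty s≤k ⟩
    length (subsetsOfSize k s)                          ≡⟨ length-map (inside ∷_) (subsetsOfSize k s) ⟨
    length with-k                                       ≤⟨ m≤n+m (length with-k) (length without-k) ⟩
    length without-k + length with-k                    ≡⟨ length-++ without-k ⟨
    length (without-k ++ with-k)                        ∎
    where
    open ≤-Reasoning
    without-k with-k : List (Subset (suc k))
    without-k = map (outside ∷_) (subsetsOfSize k (suc s))
    with-k = map (inside ∷_) (subsetsOfSize k s)

  record Swap (A B : Subset n) (σ : Fin n → Fin n) : Set where
    field
      involutive : ∀ x → σ (σ x) ≡ x
      A→B : x ∈ A → σ x ∈ B
      B→A : x ∈ B → σ x ∈ A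
      fixes : x ∉ A → x ∉ B → σ x ≡ x

  module SwapStep {A B : Subset n} (A∩B≡∅ : ∀ {x} → x ∈ A → x ∉ B) {a b : Fin n} (a∈A : a ∈ A) (b∈B : b ∈ B)
                  {σ′ : Fin n → Fin n} (sw′ : Swap (A - a) (B - b) σ′) where

    private
      module S′ = Swap sw′

      b∉A : b ∉ A
      b∉A b∈A = A∩B≡∅ b∈A b∈B

      a≢b : a ≢ b
      a≢b refl = b∉A a∈A

      x∉p-x : ∀ {p} (x : Fin n) → x ∉ p - x
      x∉p-x x x∈p-x = x∈p─q⇒x∉q x∈p-x (x∈⁅x⁆ x)

      σ′a≡a : σ′ a ≡ a
      σ′a≡a = S′.fixes (x∉p-x a) (λ a∈B-b → A∩B≡∅ a∈A (p─q⊆p B _ a∈B-b))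

      σ′b≡b : σ′ b ≡ b
      σ′b≡b = S′.fixes (λ b∈A-a → b∉A (p─q⊆p A _ b∈A-a)) (x∉p-x b)

      pick : ∀ {x} → Dec (x ≡ a) → Dec (x ≡ b) → Fin n
      pick (yes _) _ = b
      pick (no _) (yes _) = a
      pick {x} (no _) (no _) = σ′ x

    σ : Fin n → Fin n
    σ x = pick (x ≟ a) (x ≟ b)

    private
      σa≡b : σ a ≡ b
      σa≡b with a ≟ a
      ... | yes _ = refl
      ... | no a≢a = contradiction refl a≢a

      σb≡a : σ b ≡ a
      σb≡a with b ≟ a | b ≟ b
      ... | yes b≡a | _ = contradiction (sym b≡a) a≢b
      ... | no _ | yes _ = refl
      ... | no _ | no b≢b = contradiction refl b≢b

      σ≡σ′ : ∀ {x} → x ≢ a → x ≢ b → σ x ≡ σ′ x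
      σ≡σ′ {x} x≢a x≢b with x ≟ a | x ≟ b
      ... | yes x≡a | _ = contradiction x≡a x≢a
      ... | no _ | yes x≡b = contradiction x≡b x≢b
      ... | no _ | no _ = refl

      σ′-avoids : ∀ {x} → x ≢ a → x ≢ b → σ′ x ≢ a × σ′ x ≢ b
      σ′-avoids {x} x≢a x≢b =
        (λ σ′x≡a → x≢a (trans (sym (S′.involutive x)) (trans (cong σ′ σ′x≡a) σ′a≡a))) ,
        (λ σ′x≡b → x≢b (trans (sym (S′.involutive x)) (trans (cong σ′ σ′x≡b) σ′b≡b)))

      involutive : ∀ x → σ (σ x) ≡ x
      involutive x = by-cases (x ≟ a) (x ≟ b)
        where
        by-cases : Dec (x ≡ a) → Dec (x ≡ b) → σ (σ x) ≡ x
        by-cases (yes refl) _ = trans (cong σ σa≡b) σb≡a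
        by-cases (no _) (yes refl) = trans (cong σ σb≡a) σa≡b
        by-cases (no x≢a) (no x≢b) = let (σ′x≢a , σ′x≢b) = σ′-avoids x≢a x≢b in
          trans (cong σ (σ≡σ′ x≢a x≢b)) (trans (σ≡σ′ σ′x≢a σ′x≢b) (S′.involutive x))

      A→B : ∀ {x} → x ∈ A → σ x ∈ B
      A→B {x} x∈A = by-cases (x ≟ a)
        where
        by-cases : Dec (x ≡ a) → σ x ∈ B
        by-cases (yes refl) = subst (_∈ B) (sym σa≡b) b∈B
        by-cases (no x≢a) = subst (_∈ B) (sym (σ≡σ′ x≢a (λ { refl → b∉A x∈A })))
                              (p─q⊆p B _ (S′.A→B (x∈p∧x≢y⇒x∈p-y x∈A x≢a)))

      B→A : ∀ {x} → x ∈ B → σ x ∈ A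
      B→A {x} x∈B = by-cases (x ≟ b)
        where
        by-cases : Dec (x ≡ b) → σ x ∈ A
        by-cases (yes refl) = subst (_∈ A) (sym σb≡a) a∈A
        by-cases (no x≢b) = subst (_∈ A) (sym (σ≡σ′ (λ { refl → A∩B≡∅ a∈A x∈B }) x≢b))
                              (p─q⊆p A _ (S′.B→A (x∈p∧x≢y⇒x∈p-y x∈B x≢b)))

      fixes : ∀ {x} → x ∉ A → x ∉ B → σ x ≡ x
      fixes {x} x∉A x∉B = trans (σ≡σ′ (λ { refl → x∉A a∈A }) (λ { refl → x∉B b∈B }))
                            (S′.fixes (x∉A ∘ p─q⊆p A _) (x∉B ∘ p─q⊆p B _))

    σ-swaps : Swap A B σ
    σ-swaps = record { involutive = involutive ; A→B = A→B ; B→A = B→A ; fixes = fixes }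

  swapOfSize : ∀ m {A B : Subset n} → ∣ A ∣ ≡ m → ∣ B ∣ ≡ m → (∀ {x} → x ∈ A → x ∉ B) → ∃ (Swap A B)
  swapOfSize zero ∣A∣≡0 ∣B∣≡0 _ = id , record
    { involutive = λ _ → refl
    ; A→B = λ x∈A → contradiction x∈A (∣p∣≡0⇒x∉p ∣A∣≡0)
    ; B→A = λ x∈B → contradiction x∈B (∣p∣≡0⇒x∉p ∣B∣≡0)
    ; fixes = λ _ _ → refl
    }
  swapOfSize (suc m) {A} {B} ∣A∣≡1+m ∣B∣≡1+m A∩B≡∅
    with a , a∈A ← ∣p∣≡suc⇒Nonempty ∣A∣≡1+m
       | b , b∈B ← ∣p∣≡suc⇒Nonempty ∣B∣≡1+m
    with σ′ , sw′ ← swapOfSize m {A - a} {B - b}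
                      (suc-injective (trans (suc∣p-x∣≡∣p∣ a∈A) ∣A∣≡1+m))
                      (suc-injective (trans (suc∣p-x∣≡∣p∣ b∈B) ∣B∣≡1+m))
                      (λ x∈A-a x∈B-b → A∩B≡∅ (p─q⊆p A _ x∈A-a) (p─q⊆p B _ x∈B-b))
    = SwapStep.σ A∩B≡∅ a∈A b∈B sw′ , SwapStep.σ-swaps A∩B≡∅ a∈A b∈B sw′

  swap : ∀ {A B : Subset n} → (∀ {x} → x ∈ A → x ∉ B) → ∣ A ∣ ≡ ∣ B ∣ → ∃ (Swap A B)
  swap A∩B≡∅ ∣A∣≡∣B∣ = swapOfSize _ refl (sym ∣A∣≡∣B∣) A∩B≡∅

  swap-sym : ∀ {A B : Subset n} {σ} → Swap A B σ → Swap B A σ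
  swap-sym sw = record { involutive = involutive ; A→B = B→A ; B→A = A→B ; fixes = λ x∉B x∉A → fixes x∉A x∉B }
    where open Swap sw

  swap-∉ : ∀ {A B : Subset n} {σ} → Swap A B σ → (∀ {x} → x ∈ A → x ∉ B) → x ∉ A → σ x ∉ B
  swap-∉ {x = x} {B = B} sw A∩B≡∅ x∉A with x ∈? B
  ... | yes x∈B = A∩B≡∅ (Swap.B→A sw x∈B)
  ... | no x∉B = subst (_∉ B) (sym (Swap.fixes sw x∉A x∉B)) x∉B

-- Walks, paths and conflict-free colourings

module _ {n : ℕ} (G : Graph n) where

  private variable
    W W′ : Subset n
    u v w x : Fin n
    p q : List (Fin n)

  Adj-sym : Adj G u v → Adj G v u
  Adj-sym {u} {v} uv = trans (adj-sym G v u) uv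

  Adj⇒≢ : Adj G u v → u ≢ v
  Adj⇒≢ {u} uu refl with () ← trans (sym (irrefl G u)) uu

  walk-∈ : Walk G W u v p → All (_∈ W) p
  walk-∈ (single u∈W) = u∈W ∷ []
  walk-∈ (step u∈W _ wk) = u∈W ∷ walk-∈ wk

  walk-restrict : All (_∈ W′) p → Walk G W u v p → Walk G W′ u v p
  walk-restrict (u∈W′ ∷ []) (single _) = single u∈W′
  walk-restrict (u∈W′ ∷ p⊆W′) (step _ uw wk) = step u∈W′ uw (walk-restrict p⊆W′ wk)

  path-restrict : All (_∈ W′) p → IsPath G W u v p → IsPath G W′ u v p
  path-restrict p⊆W′ (wk , u) = walk-restrict p⊆W′ wk , u

  path-⊤ : IsPath G W u v p → IsPath G ⊤ u v p
  path-⊤ (wk , u) = walk-restrict (All.map (λ _ → ∈⊤) (walk-∈ wk)) wk , u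

  first∈walk : Walk G W u v p → u ∈ₗ p
  first∈walk (single _) = here refl
  first∈walk (step _ _ _) = here refl

  walk-head : Walk G W u v (w ∷ p) → u ≡ w
  walk-head (single _) = refl
  walk-head (step _ _ _) = refl

  last∈walk : Walk G W u v p → v ∈ₗ p
  last∈walk (single _) = here refl
  last∈walk (step _ _ wk) = there (last∈walk wk)

  walk-length≥2 : u ≢ v → Walk G W u v p → 2 ≤ length p
  walk-length≥2 u≢v (single _) = contradiction refl u≢v
  walk-length≥2 _ (step _ _ (single _)) = s≤s (s≤s z≤n)
  walk-length≥2 _ (step _ _ (step _ _ _)) = s≤s (s≤s z≤n)

  walk-length≥3 : u ≢ v → ¬ Adj G u v → Walk G W u v p → 3 ≤ length p
  walk-length≥3 u≢v _ (single _) = contradiction refl u≢v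
  walk-length≥3 _ ¬uv (step _ uv (single _)) = contradiction uv ¬uv
  walk-length≥3 _ _ (step _ _ (step _ _ (single _))) = s≤s (s≤s (s≤s z≤n))
  walk-length≥3 _ _ (step _ _ (step _ _ (step _ _ _))) = s≤s (s≤s (s≤s z≤n))

  walk-∷ʳ : Walk G W u v p → Adj G v x → x ∈ W → Walk G W u x (p ∷ʳ x)
  walk-∷ʳ (single u∈W) ux x∈W = step u∈W ux (single x∈W)
  walk-∷ʳ (step u∈W uw wk) vx x∈W = step u∈W uw (walk-∷ʳ wk vx x∈W)

  walk-reverse : Walk G W u v p → Walk G W v u (reverse p)
  walk-reverse (single u∈W) = single u∈W
  walk-reverse {u = u} (step {p = p} u∈W uw wk) rewrite unfold-reverse u p =
    walk-∷ʳ (walk-reverse wk) (Adj-sym uw) u∈W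

  shortestPath-reverse : IsShortestPath G W u v p → IsShortestPath G W v u (reverse p)
  shortestPath-reverse {p = p} ((wk , u) , shortest) =
    (walk-reverse wk , unique-reverse u) , λ q (wk′ , u′) → begin
      length (reverse p)          ≡⟨ length-reverse p ⟩
      length p                    ≤⟨ shortest (reverse q) (walk-reverse wk′ , unique-reverse u′) ⟩
      length (reverse q)          ≡⟨ length-reverse q ⟩
      length q                    ∎
    where open ≤-Reasoning

  walk-map : ∀ {g : Fin n → Fin n} → (∀ {a b} → Adj G a b → Adj G (g a) (g b)) →
             All (λ x → g x ∈ W′) p → Walk G W u v p → Walk G W′ (g u) (g v) (map g p)
  walk-map _ (gu∈W′ ∷ []) (single _) = single gu∈W′
  walk-map g-hom (gu∈W′ ∷ gp⊆W′) (step _ uw wk) = step gu∈W′ (g-hom uw) (walk-map g-hom gp⊆W′ wk)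

  path-map : ∀ {g : Fin n → Fin n} → (∀ {a b} → Adj G a b → Adj G (g a) (g b)) →
             (∀ {x y} → x ∈ₗ p → y ∈ₗ p → g x ≡ g y → x ≡ y) →
             All (λ x → g x ∈ W′) p → IsPath G W u v p → IsPath G W′ (g u) (g v) (map g p)
  path-map g-hom g-inj gp⊆W′ (wk , u) = walk-map g-hom gp⊆W′ wk , unique-map⁺ g-inj u

  suffix-path : Walk G W w v q → Unique q → u ∈ₗ q → ∃ λ q′ → IsPath G W u v q′ × length q′ ≤ length q
  suffix-path wk@(single _) u (here refl) = _ , (wk , u) , ≤-refl
  suffix-path wk@(step _ _ _) u (here refl) = _ , (wk , u) , ≤-refl
  suffix-path (step _ _ wk) (_ ∷ u) (there u∈q) with q′ , path , q′≤q ← suffix-path wk u u∈q =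
    q′ , path , m≤n⇒m≤1+n q′≤q

  path-∷ : u ∈ W → Adj G u w → IsPath G W w v q → ∃ λ q′ → IsPath G W u v q′ × length q′ ≤ suc (length q)
  path-∷ {u = u} {q = q} u∈W uw (wk , q-unique) with any? (u ≟_) q
  ... | no u∉q = u ∷ q , (step u∈W uw wk , unique-∷ u∉q q-unique) , ≤-refl
  ... | yes u∈q = let q′ , path , q′≤q = suffix-path wk q-unique u∈q in q′ , path , m≤n⇒m≤1+n q′≤q

  walk⇒path-via : ∀ {g : Fin n → Fin n} →
    (∀ {a b} → a ∈ W → b ∈ W → Adj G a b → g a ≡ g b ⊎ Adj G (g a) (g b)) → (∀ {a} → a ∈ W → g a ∈ W′) →
    Walk G W u v p → ∃ λ q → IsPath G W′ (g u) (g v) q × length q ≤ length p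
  walk⇒path-via _ g∈W′ (single u∈W) = _ , (single (g∈W′ u∈W) , [] ∷ []) , ≤-refl
  walk⇒path-via {W = W} {W′ = W′} {u = u} {v = v} {g = g} g-edge g∈W′ (step {w = w} {p = p} u∈W uw wk) =
    extend (g-edge u∈W (All.lookup (walk-∈ wk) (first∈walk wk)) uw) (walk⇒path-via g-edge g∈W′ wk)
    where
    extend : g u ≡ g w ⊎ Adj G (g u) (g w) →
             (∃ λ q → IsPath G W′ (g w) (g v) q × length q ≤ length p) →
             ∃ λ q → IsPath G W′ (g u) (g v) q × length q ≤ suc (length p)
    extend (inj₁ gu≡gw) (q , path , q≤p) =
      q , subst (λ a → IsPath G W′ a (g v) q) (sym gu≡gw) path , m≤n⇒m≤1+n q≤p
    extend (inj₂ gu-gw) (q , path , q≤p) =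
      let q′ , path′ , q′≤1+q = path-∷ (g∈W′ u∈W) gu-gw path in q′ , path′ , ≤-trans q′≤1+q (s≤s q≤p)

  edge-shortestPath : u ∈ W → v ∈ W → Adj G u v → IsShortestPath G W u v (u ∷ v ∷ [])
  edge-shortestPath u∈W v∈W uv =
    (step u∈W uv (single v∈W) , unique-∷ (λ { (here u≡v) → Adj⇒≢ uv u≡v }) ([] ∷ [])) ,
    λ _ (wk , _) → walk-length≥2 (Adj⇒≢ uv) wk

  length₃-shortestPath : u ≢ v → ¬ Adj G u v → IsPath G W u v (u ∷ x ∷ v ∷ []) →
                         IsShortestPath G W u v (u ∷ x ∷ v ∷ [])
  length₃-shortestPath u≢v ¬uv path = path , λ _ (wk , _) → walk-length≥3 u≢v ¬uv wk

  walk-length≤2 : u ≢ v → Walk G W u v p → length p ≤ 2 → p ≡ u ∷ v ∷ []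
  walk-length≤2 u≢v (single _) _ = contradiction refl u≢v
  walk-length≤2 _ (step _ _ (single _)) _ = refl
  walk-length≤2 _ (step _ _ (step _ _ (single _))) (s≤s (s≤s ()))
  walk-length≤2 _ (step _ _ (step _ _ (step _ _ _))) (s≤s (s≤s ()))

  conflictFree⇔ : ∀ {k} (c : Fin n → Fin k) p → ConflictFree G c p ⇔ OccursOnce (map c p)
  conflictFree⇔ c p = mk⇔ (λ (i , once) → i , trans (sym (length-filter-map (_≟ i) c p)) once)
                          (λ (i , once) → i , trans (length-filter-map (_≟ i) c p) once)

  conflictFree-resp : ∀ {k} {c c′ : Fin n → Fin k} → map c p ≡ map c′ q →
                      ConflictFree G c p → ConflictFree G c′ q
  conflictFree-resp {p} {q} {c = c} {c′} c[p]≡c′[q] cf =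
    from (conflictFree⇔ c′ q) (subst OccursOnce c[p]≡c′[q] (to (conflictFree⇔ c p) cf))

  conflictFree-reverse : ∀ {k} {c : Fin n → Fin k} → ConflictFree G c p → ConflictFree G c (reverse p)
  conflictFree-reverse {p = p} {c = c} (i , once) =
    i , trans (↭-length (filter-↭ (λ x → c x ≟ i) (↭-reverse p))) once

  strong⇒proper : ∀ {k} {c : Fin n → Fin k} → StrongCFVC G W c →
                  u ∈ W → v ∈ W → Adj G u v → c u ≢ c v
  strong⇒proper {u = u} {v = v} {c = c} sc u∈W v∈W uv cu≡cv
    with p , ((wk , _) , shortest) , cf ← sc u v u∈W v∈W (Adj⇒≢ uv)
    with refl ← walk-length≤2 (Adj⇒≢ uv) wk (shortest _ (proj₁ (edge-shortestPath u∈W v∈W uv)))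
    = ¬once-pair {i = c u}
        (subst (λ i → OccursOnce (c u ∷ i ∷ [])) (sym cu≡cv) (to (conflictFree⇔ c (u ∷ v ∷ [])) cf))

  strong-transport : ∀ {k} {c : Fin n → Fin k} {σ : Fin n → Fin n} → (∀ x → σ (σ x) ≡ x) →
    (∀ {a b} → Adj G a b → Adj G (σ a) (σ b)) → (∀ {a} → a ∈ W → σ a ∈ W′) → (∀ {a} → a ∈ W′ → σ a ∈ W) →
    StrongCFVC G W′ c → StrongCFVC G W (c ∘ σ)
  strong-transport {W = W} {W′ = W′} {c = c} {σ} involutive σ-hom W→W′ W′→W sc u v u∈W v∈W u≢v
    with p , ((wk , p-unique) , shortest) , cf ←
           sc (σ u) (σ v) (W→W′ u∈W) (W→W′ v∈W) (u≢v ∘ involutive⇒injective involutive)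
    = map σ p , (path , shortest′) , conflictFree-resp recolour cf
    where
    path : IsPath G W u v (map σ p)
    path = subst₂ (λ a b → IsPath G W a b (map σ p)) (involutive u) (involutive v)
             (path-map σ-hom (λ _ _ → involutive⇒injective involutive) (All.map W′→W (walk-∈ wk)) (wk , p-unique))

    shortest′ : ∀ q → IsPath G W u v q → length (map σ p) ≤ length q
    shortest′ q (wk′ , q-unique) = begin
      length (map σ p)   ≡⟨ length-map σ p ⟩
      length p           ≤⟨ shortest (map σ q) (path-map σ-hom (λ _ _ → involutive⇒injective involutive)
                                                         (All.map W→W′ (walk-∈ wk′)) (wk′ , q-unique)) ⟩
      length (map σ q)   ≡⟨ length-map σ q ⟩
      length q           ∎
      where open ≤-Reasoning

    recolour : map c p ≡ map (c ∘ σ) (map σ p)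
    recolour = trans (sym (map-cong (cong c ∘ involutive) p)) (map-∘ p)

-- Twin covers and twin-cliques

module TwinCoverFacts {n : ℕ} {G : Graph n} {X : Subset n} (tc : TwinCover G ⊤ X) where

  private variable
    W : Subset n
    a b u v w x y z : Fin n
    p : List (Fin n)

  twins : a ∉ X → b ∉ X → Adj G a b → TrueTwins G ⊤ a b
  twins a∉X b∉X ab = proj₂ tc _ _ (∉⇒∈⊤─ a∉X) (∉⇒∈⊤─ b∉X) ab

  twin-adj : TrueTwins G ⊤ a b → Adj G z b → z ≢ a → Adj G z a
  twin-adj (_ , N[a]≡N[b]) zb z≢a with from (N[a]≡N[b] _ ∈⊤) (inj₂ zb)
  ... | inj₁ z≡a = contradiction z≡a z≢a
  ... | inj₂ za = za

  shortcut : Walk G W u v p → Unique p → Consecutive (_∉ X) p → 3 ≤ length p →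
             ∃ λ q → IsPath G W u v q × length q < length p
  shortcut (step _ _ (single _)) _ (here _ _) (s≤s (s≤s ()))
  shortcut (step _ _ (single _)) _ (there (there ())) _
  shortcut (step _ _ (step _ _ (single _))) _ (there (there (there ()))) _
  shortcut {u = u} (step u∈W uw (step {w = z} _ wz wk)) ((_ ∷ u∉p) ∷ _ ∷ p-unique) (here u∉X w∉X) _ =
    _ , (step u∈W (Adj-sym G zu) wk , u∉p ∷ p-unique) , ≤-refl
    where
    zu : Adj G z u
    zu = twin-adj (twins u∉X w∉X uw) (Adj-sym G wz) (λ z≡u → All.lookup u∉p (first∈walk G wk) (sym z≡u))
  shortcut {u = u} (step u∈W uw (step {w = x} _ wx wk)) ((_ ∷ u∉p) ∷ _ ∷ p-unique) (there (here w∉X x∉X)) _ =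
    _ , (step u∈W ux wk , u∉p ∷ p-unique) , ≤-refl
    where
    ux : Adj G u x
    ux = twin-adj (twins (subst (_∉ X) (sym (walk-head G wk)) x∉X) w∉X (Adj-sym G wx)) uw
                  (λ u≡x → All.lookup u∉p (first∈walk G wk) u≡x)
  shortcut (step u∈W uw wk@(step _ _ (step _ _ wk′))) (_ ∷ p-unique) (there c) _
    with q , path , q<p ← shortcut wk p-unique c (s≤s (s≤s (∈-length (first∈walk G wk′))))
    with q′ , path′ , q′≤1+q ← path-∷ G u∈W uw path
    = q′ , path′ , ≤-trans (s≤s q′≤1+q) (s≤s q<p)

  shortestPath⇒¬Consecutive : IsShortestPath G W u v p → 3 ≤ length p → ¬ Consecutive (_∉ X) p
  shortestPath⇒¬Consecutive ((wk , p-unique) , shortest) 3≤p c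
    with q , path , q<p ← shortcut wk p-unique c 3≤p = <⇒≱ q<p (shortest q path)

  shortestPath-length-filter-∉ : IsShortestPath G W u v p → 3 ≤ length p →
                                  length (filter (∁? (_∈? X)) p) ≤ suc ∣ X ∣
  shortestPath-length-filter-∉ {p = p} sp@((_ , p-unique) , _) 3≤p = ≤-trans
    (¬Consecutive⇒length-filter-∁ (_∈? X) p (shortestPath⇒¬Consecutive sp 3≤p))
    (s≤s (unique-length-≤-∣p∣ (filter⁺ (_∈? X) p-unique) (all-filter (_∈? X) p)))

  module Clique {S : Subset n} {s : ℕ} {D : Subset n} (D∈𝒞 : InCSs G ⊤ X S s D) where

    private
      D⊆V─X : D ⊆ ⊤ ─ X
      D⊆V─X = proj₁ (proj₁ D∈𝒞)

      D-connected : ∀ u v → u ∈ D → v ∈ D → ∃ λ p → IsPath G D u v p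
      D-connected = proj₁ (proj₂ (proj₂ (proj₁ D∈𝒞)))

      D-closed : ∀ u w → u ∈ D → w ∈ ⊤ ─ X → Adj G u w → w ∈ D
      D-closed = proj₂ (proj₂ (proj₂ (proj₁ D∈𝒞)))

      N[D]≡S : NXis G X D S
      N[D]≡S = proj₁ (proj₂ D∈𝒞)

    ∉X : a ∈ D → a ∉ X
    ∉X = x∈p─q⇒x∉q ∘ D⊆V─X

    S⊆X : x ∈ S → x ∈ X
    S⊆X x∈S = proj₁ (to (N[D]≡S _) x∈S)

    ∉S : a ∈ D → a ∉ S
    ∉S a∈D = ∉X a∈D ∘ S⊆X

    adjacent : a ∈ D → b ∈ D → a ≢ b → Adj G a b
    adjacent {b = b} a∈D b∈D a≢b with _ , (wk , _) ← D-connected _ b a∈D b∈D = along wk a∈D a≢b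
      where
      along : ∀ {a q} → Walk G D a b q → a ∈ D → a ≢ b → Adj G a b
      along (single _) _ a≢b = contradiction refl a≢b
      along {a} (step {w = w} _ aw wk) a∈D a≢b with w ≟ b
      ... | yes refl = aw
      ... | no w≢b = Adj-sym G (twin-adj (twins (∉X a∈D) (∉X w∈D) aw) (Adj-sym G (along wk w∈D w≢b)) (a≢b ∘ sym))
        where
        w∈D : w ∈ D
        w∈D = All.lookup (walk-∈ G wk) (first∈walk G wk)

    adjacent-S : a ∈ D → x ∈ S → Adj G a x
    adjacent-S {a} {x} a∈D x∈S with to (N[D]≡S x) x∈S
    ... | x∈X , d , d∈D , dx with d ≟ a
    ...   | yes refl = dx
    ...   | no d≢a = Adj-sym G (twin-adj (twins (∉X a∈D) (∉X d∈D) (adjacent a∈D d∈D (d≢a ∘ sym)))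
                                (Adj-sym G dx) (λ x≡a → ∉X a∈D (subst (_∈ X) x≡a x∈X)))

    neighbour : a ∈ D → Adj G a y → y ∈ D ⊎ y ∈ S
    neighbour {a} {y} a∈D ay with y ∈? X
    ... | yes y∈X = inj₂ (from (N[D]≡S y) (y∈X , a , a∈D , ay))
    ... | no y∉X = inj₁ (D-closed a y a∈D (∉⇒∈⊤─ y∉X) ay)

    exit∈S : a ∈ D → b ∉ D → Adj G a b → b ∈ S
    exit∈S a∈D b∉D ab with neighbour a∈D ab
    ... | inj₁ b∈D = contradiction b∈D b∉D
    ... | inj₂ b∈S = b∈S

    leaving⇒S-nonempty : Walk G W a b p → a ∈ D → b ∉ D → Nonempty S
    leaving⇒S-nonempty (single _) a∈D a∉D = contradiction a∈D a∉D
    leaving⇒S-nonempty (step _ aw wk) a∈D b∉D with neighbour a∈D aw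
    ... | inj₁ w∈D = leaving⇒S-nonempty wk w∈D b∉D
    ... | inj₂ w∈S = _ , w∈S

  private variable
    S S′ : Subset n
    s s′ : ℕ
    D D′ : Subset n

  shared-vertex⇒≡ : InCSs G ⊤ X S s D → InCSs G ⊤ X S′ s′ D′ → v ∈ D → v ∈ D′ → D ≡ D′
  shared-vertex⇒≡ D∈𝒞 D′∈𝒞 v∈D v∈D′ = ⊆-antisym (⊆-shared D∈𝒞 D′∈𝒞 v∈D v∈D′) (⊆-shared D′∈𝒞 D∈𝒞 v∈D′ v∈D)
    where
    ⊆-shared : InCSs G ⊤ X S s D → InCSs G ⊤ X S′ s′ D′ → v ∈ D → v ∈ D′ → ∀ {a} → a ∈ D → a ∈ D′
    ⊆-shared {v = v} D∈𝒞 D′∈𝒞 v∈D v∈D′ {a} a∈D with a ≟ v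
    ... | yes refl = v∈D′
    ... | no a≢v = proj₂ (proj₂ (proj₂ (proj₁ D′∈𝒞))) v a v∈D′ (proj₁ (proj₁ D∈𝒞) a∈D)
                     (Clique.adjacent D∈𝒞 v∈D a∈D (a≢v ∘ sym))

  disjoint : InCSs G ⊤ X S s D → InCSs G ⊤ X S′ s′ D′ → D ≢ D′ → v ∈ D → v ∉ D′
  disjoint D∈𝒞 D′∈𝒞 D≢D′ v∈D v∈D′ = D≢D′ (shared-vertex⇒≡ D∈𝒞 D′∈𝒞 v∈D v∈D′)

  nonadjacent : InCSs G ⊤ X S s D → InCSs G ⊤ X S′ s′ D′ → D ≢ D′ → a ∈ D → b ∈ D′ → ¬ Adj G a b
  nonadjacent D∈𝒞 D′∈𝒞 D≢D′ a∈D b∈D′ ab with Clique.neighbour D∈𝒞 a∈D ab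
  ... | inj₁ b∈D = disjoint D∈𝒞 D′∈𝒞 D≢D′ b∈D b∈D′
  ... | inj₂ b∈S = Clique.∉X D′∈𝒞 b∈D′ (Clique.S⊆X D∈𝒞 b∈S)

-- Removing a twin-clique C ∈ 𝒞_{S,s}

module _ {n : ℕ} {G : Graph n} {X : Subset n} (tc : TwinCover G ⊤ X)
         {S : Subset n} {s : ℕ} {C : Subset n} (C∈𝒞 : InCSs G ⊤ X S s C) where

  open TwinCoverFacts {G = G} {X = X} tc

  private
    𝒞 = InCSs G ⊤ X S s
    variable
      D : Subset n
      u v w : Fin n
      p : List (Fin n)

  removal-twinCover : TwinCover G (⊤ ─ C) X
  removal-twinCover = (λ x∈X → ∉⇒∈⊤─ (λ x∈C → Clique.∉X C∈𝒞 x∈C x∈X)) , twins′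
    where
    twins′ : ∀ u v → u ∈ ⊤ ─ C ─ X → v ∈ ⊤ ─ C ─ X → Adj G u v → TrueTwins G (⊤ ─ C) u v
    twins′ u v u∈ v∈ uv with u≢v , N[u]≡N[v] ← twins (x∈p─q⇒x∉q u∈) (x∈p─q⇒x∉q v∈) uv =
      u≢v , λ x _ → N[u]≡N[v] x ∈⊤

  other-clique⊆V─C : 𝒞 D → D ≢ C → v ∈ D → v ∈ ⊤ ─ C
  other-clique⊆V─C D∈𝒞 D≢C v∈D = ∉⇒∈⊤─ (disjoint D∈𝒞 C∈𝒞 D≢C v∈D)

  S⊆V─C : v ∈ S → v ∈ ⊤ ─ C
  S⊆V─C v∈S = ∉⇒∈⊤─ (λ v∈C → Clique.∉S C∈𝒞 v∈C v∈S)

  -- Neighbours of C outside C lie in S, and w sees all of S.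
  module Redirect (D∈𝒞 : 𝒞 D) (D≢C : D ≢ C) (w∈D : w ∈ D) where

    redirect : Fin n → Fin n
    redirect x with x ∈? C
    ... | yes _ = w
    ... | no _ = x

    redirect-∈ : u ∈ C → redirect u ≡ w
    redirect-∈ {u} u∈C with u ∈? C
    ... | yes _ = refl
    ... | no u∉C = contradiction u∈C u∉C

    redirect-∉ : u ∉ C → redirect u ≡ u
    redirect-∉ {u} u∉C with u ∈? C
    ... | yes u∈C = contradiction u∈C u∉C
    ... | no _ = refl

    w∉C : w ∉ C
    w∉C = disjoint D∈𝒞 C∈𝒞 D≢C w∈D

    redirect-∈⊤─C : ∀ {u} → u ∈ ⊤ → redirect u ∈ ⊤ ─ C
    redirect-∈⊤─C {u} _ with u ∈? C
    ... | yes _ = ∉⇒∈⊤─ w∉C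
    ... | no u∉C = ∉⇒∈⊤─ u∉C

    redirect-edge : ∀ {a b} → a ∈ ⊤ → b ∈ ⊤ → Adj G a b → redirect a ≡ redirect b ⊎ Adj G (redirect a) (redirect b)
    redirect-edge {a} {b} _ _ ab with a ∈? C | b ∈? C
    ... | yes _ | yes _ = inj₁ refl
    ... | yes a∈C | no b∉C = inj₂ (Clique.adjacent-S D∈𝒞 w∈D (Clique.exit∈S C∈𝒞 a∈C b∉C ab))
    ... | no a∉C | yes b∈C = inj₂ (Adj-sym G (Clique.adjacent-S D∈𝒞 w∈D (Clique.exit∈S C∈𝒞 b∈C a∉C (Adj-sym G ab))))
    ... | no _ | no _ = inj₂ ab

    redirect-walk : Walk G ⊤ u v p → ∃ λ q → IsPath G (⊤ ─ C) (redirect u) (redirect v) q × length q ≤ length p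
    redirect-walk = walk⇒path-via G redirect-edge redirect-∈⊤─C

  removal-connected : 𝒞 D → D ≢ C → Connected G ⊤ → Connected G (⊤ ─ C)
  removal-connected D∈𝒞 D≢C connected u v u∈ v∈
    with w , w∈D ← proj₁ (proj₂ (proj₁ D∈𝒞))
    with _ , (wk , _) ← connected u v ∈⊤ ∈⊤
    with q , path , _ ← Redirect.redirect-walk D∈𝒞 D≢C w∈D wk
    = q , subst₂ (λ a b → IsPath G (⊤ ─ C) a b q)
            (Redirect.redirect-∉ D∈𝒞 D≢C w∈D (x∈p─q⇒x∉q u∈)) (Redirect.redirect-∉ D∈𝒞 D≢C w∈D (x∈p─q⇒x∉q v∈)) path

  removal-shortestPath : 𝒞 D → D ≢ C → u ∉ C → v ∉ C → IsShortestPath G (⊤ ─ C) u v p → IsShortestPath G ⊤ u v p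
  removal-shortestPath {D} {u} {v} D∈𝒞 D≢C u∉C v∉C (path , shortest)
    with w , w∈D ← proj₁ (proj₂ (proj₁ D∈𝒞))
    = path-⊤ G path , λ q (wk , _) →
      let q′ , path′ , q′≤q = redirect-walk wk in
      ≤-trans (shortest q′ (subst₂ (λ a b → IsPath G (⊤ ─ C) a b q′) (redirect-∉ u∉C) (redirect-∉ v∉C) path′)) q′≤q
    where open Redirect D∈𝒞 D≢C w∈D

  path-via-S : ∀ {W D D′ a b x} → 𝒞 D → 𝒞 D′ → D ≢ D′ → a ∈ D → b ∈ D′ → x ∈ S →
               a ∈ W → x ∈ W → b ∈ W → IsShortestPath G W a b (a ∷ x ∷ b ∷ [])
  path-via-S {a = a} {b} D∈𝒞 D′∈𝒞 D≢D′ a∈D b∈D′ x∈S a∈W x∈W b∈W = length₃-shortestPath G a≢b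
    (nonadjacent D∈𝒞 D′∈𝒞 D≢D′ a∈D b∈D′)
    ( step a∈W (Clique.adjacent-S D∈𝒞 a∈D x∈S) (step x∈W (Adj-sym G (Clique.adjacent-S D′∈𝒞 b∈D′ x∈S)) (single b∈W))
    , unique-∷ (λ { (here a≡x) → Clique.∉S D∈𝒞 a∈D (subst (_∈ S) (sym a≡x) x∈S)
                  ; (there (here a≡b)) → a≢b a≡b })
        (unique-∷ (λ { (here x≡b) → Clique.∉S D′∈𝒞 b∈D′ (subst (_∈ S) x≡b x∈S) }) ([] ∷ [])))
    where
    a≢b : a ≢ b
    a≢b a≡b = disjoint D∈𝒞 D′∈𝒞 D≢D′ a∈D (subst (_∈ _) (sym a≡b) b∈D′)

  SeparatedByS : ∀ {k} → (Fin n → Fin k) → Subset n → Set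
  SeparatedByS c D = ∀ {v} → v ∈ D → ∃ λ x → x ∈ S × c x ≢ c v

  module Extension {k} {c : Fin n → Fin k} (sc : StrongCFVC G (⊤ ─ C) c)
                   (D∈𝒞 : 𝒞 D) (D≢C : D ≢ C) (separated : SeparatedByS c D) {σ} (sw : Swap C D σ) where

    open Swap sw

    extension : Fin n → Fin k
    extension x with x ∈? C
    ... | yes _ = c (σ x)
    ... | no _ = c x

    extension-∈ : u ∈ C → extension u ≡ c (σ u)
    extension-∈ {u} u∈C with u ∈? C
    ... | yes _ = refl
    ... | no u∉C = contradiction u∈C u∉C

    extension-∉ : u ∉ C → extension u ≡ c u
    extension-∉ {u} u∉C with u ∈? C
    ... | yes u∈C = contradiction u∈C u∉C
    ... | no _ = refl

    extension-outside : All (_∈ ⊤ ─ C) p → map extension p ≡ map c p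
    extension-outside [] = refl
    extension-outside (u∈ ∷ p⊆) = cong₂ _∷_ (extension-∉ (x∈p─q⇒x∉q u∈)) (extension-outside p⊆)

    D⊆V─C : v ∈ D → v ∈ ⊤ ─ C
    D⊆V─C = other-clique⊆V─C D∈𝒞 D≢C

    Solution : Fin n → Fin n → Set
    Solution u v = ∃ λ p → IsShortestPath G ⊤ u v p × ConflictFree G extension p

    solution-reverse : Solution u v → Solution v u
    solution-reverse (p , sp , cf) = reverse p , shortestPath-reverse G sp , conflictFree-reverse G {p = p} cf

    outside-C : u ∉ C → v ∉ C → u ≢ v → Solution u v
    outside-C u∉C v∉C u≢v with p , sp , cf ← sc _ _ (∉⇒∈⊤─ u∉C) (∉⇒∈⊤─ v∉C) u≢v =
      p , removal-shortestPath D∈𝒞 D≢C u∉C v∉C sp ,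
      conflictFree-resp G (sym (extension-outside (walk-∈ G (proj₁ (proj₁ sp))))) cf

    inside-C : u ∈ C → v ∈ C → u ≢ v → Solution u v
    inside-C {u} {v} u∈C v∈C u≢v =
      u ∷ v ∷ [] , edge-shortestPath G ∈⊤ ∈⊤ (Clique.adjacent C∈𝒞 u∈C v∈C u≢v) ,
      from (conflictFree⇔ G extension (u ∷ v ∷ [])) (once-pair distinct-colours)
      where
      distinct-colours : extension u ≢ extension v
      distinct-colours eu≡ev = strong⇒proper G sc (D⊆V─C (A→B u∈C)) (D⊆V─C (A→B v∈C))
        (Clique.adjacent D∈𝒞 (A→B u∈C) (A→B v∈C) (u≢v ∘ involutive⇒injective involutive))
        (trans (sym (extension-∈ u∈C)) (trans eu≡ev (extension-∈ v∈C)))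

    C-to-D : u ∈ C → v ∈ D → Solution u v
    C-to-D {u} {v} u∈C v∈D with x , x∈S , cx≢cv ← separated v∈D =
      u ∷ x ∷ v ∷ [] , path-via-S C∈𝒞 D∈𝒞 (D≢C ∘ sym) u∈C v∈D x∈S ∈⊤ ∈⊤ ∈⊤ ,
      from (conflictFree⇔ G extension (u ∷ x ∷ v ∷ [])) (once-triple {i = extension u} λ (_ , ex≡ev) →
        cx≢cv (trans (sym (extension-∉ (x∈p─q⇒x∉q (S⊆V─C x∈S)))) (trans ex≡ev (extension-∉ (x∈p─q⇒x∉q (D⊆V─C v∈D))))))

    -- A shortest σu–v path in G − C leaves D at once (consecutive twins would shortcut it), so its
    -- second vertex lies in S and σ u can be replaced by u; redirecting C onto σ u shows optimality.
    C-to-elsewhere : u ∈ C → v ∉ C → v ∉ D → Solution u v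
    C-to-elsewhere {u} {v} u∈C v∉C v∉D
      with p , ((wk , p-unique) , shortest) , cf ←
             sc (σ u) v (D⊆V─C (A→B u∈C)) (∉⇒∈⊤─ v∉C) (λ σu≡v → v∉D (subst (_∈ D) σu≡v (A→B u∈C)))
      = reroute wk p-unique shortest cf
      where
      σu∈D : σ u ∈ D
      σu∈D = A→B u∈C

      open Redirect D∈𝒞 D≢C σu∈D

      consecutive-start : ∀ {a y T} → a ∉ X → y ∉ X → Walk G (⊤ ─ C) y v T → Consecutive (_∉ X) (a ∷ T)
      consecutive-start a∉X y∉X (single _) = here a∉X y∉X
      consecutive-start a∉X y∉X (step _ _ _) = here a∉X y∉X

      reroute : ∀ {p} → Walk G (⊤ ─ C) (σ u) v p → Unique p →
                (∀ q → IsPath G (⊤ ─ C) (σ u) v q → length p ≤ length q) → ConflictFree G c p → Solution u v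
      reroute (single _) _ _ _ = contradiction σu∈D v∉D
      reroute (step {w = y} {p = T} σu∈ σu-y wk′) p-unique shortest cf with Clique.neighbour D∈𝒞 σu∈D σu-y
      ... | inj₁ y∈D = contradiction
            (consecutive-start (Clique.∉X D∈𝒞 σu∈D) (Clique.∉X D∈𝒞 y∈D) wk′)
            (shortestPath⇒¬Consecutive ((step σu∈ σu-y wk′ , p-unique) , shortest)
              (s≤s (walk-length≥2 G (λ y≡v → v∉D (subst (_∈ D) y≡v y∈D)) wk′)))
      ... | inj₂ y∈S = u ∷ T , (path , shortest′) , conflictFree-resp G {p = σ u ∷ T} {q = u ∷ T} recolour cf
        where
        T⊆V─C : All (_∈ ⊤ ─ C) T
        T⊆V─C = walk-∈ G wk′

        path : IsPath G ⊤ u v (u ∷ T)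
        path = step ∈⊤ (Clique.adjacent-S C∈𝒞 u∈C y∈S) (walk-restrict G (All.map (λ _ → ∈⊤) T⊆V─C) wk′) ,
               unique-∷ (λ u∈T → x∈p─q⇒x∉q (All.lookup T⊆V─C u∈T) u∈C) (AllPairs.tail p-unique)

        shortest′ : ∀ q → IsPath G ⊤ u v q → length (u ∷ T) ≤ length q
        shortest′ q (wk-q , _) with q′ , path′ , q′≤q ← redirect-walk wk-q =
          ≤-trans (shortest q′ (subst₂ (λ a b → IsPath G (⊤ ─ C) a b q′) (redirect-∈ u∈C) (redirect-∉ v∉C) path′))
                  q′≤q

        recolour : map c (σ u ∷ T) ≡ map extension (u ∷ T)
        recolour = cong₂ _∷_ (sym (extension-∈ u∈C)) (sym (extension-outside T⊆V─C))

    from-C : u ∈ C → v ∉ C → Solution u v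
    from-C {v = v} u∈C v∉C with v ∈? D
    ... | yes v∈D = C-to-D u∈C v∈D
    ... | no v∉D = C-to-elsewhere u∈C v∉C v∉D

    extension-strong : StrongCFVC G ⊤ extension
    extension-strong u v _ _ u≢v with u ∈? C | v ∈? C
    ... | yes u∈C | yes v∈C = inside-C u∈C v∈C u≢v
    ... | yes u∈C | no v∉C = from-C u∈C v∉C
    ... | no u∉C | yes v∈C = solution-reverse (from-C v∈C u∉C)
    ... | no u∉C | no v∉C = outside-C u∉C v∉C u≢v

  module _ {k} {c : Fin n → Fin k} (sc : StrongCFVC G (⊤ ─ C) c) where

    ¬monochromatic-via-S : ∀ {D₁ D₂ w₁ w₂ x} → 𝒞 D₁ → 𝒞 D₂ → D₁ ≢ C → D₂ ≢ C → D₁ ≢ D₂ →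
      w₁ ∈ D₁ → w₂ ∈ D₂ → x ∈ S → (∀ {y} → y ∈ S → c y ≡ c x) → c w₁ ≡ c x → c w₂ ≡ c x → ⊥
    ¬monochromatic-via-S {D₁} {D₂} {w₁} {w₂} {x} D₁∈𝒞 D₂∈𝒞 D₁≢C D₂≢C D₁≢D₂ w₁∈D₁ w₂∈D₂ x∈S S-mono cw₁≡cx cw₂≡cx
      with p , ((wk , _) , shortest) , cf ←
             sc w₁ w₂ (other-clique⊆V─C D₁∈𝒞 D₁≢C w₁∈D₁) (other-clique⊆V─C D₂∈𝒞 D₂≢C w₂∈D₂)
               (λ { refl → disjoint D₁∈𝒞 D₂∈𝒞 D₁≢D₂ w₁∈D₁ w₂∈D₂ })
      = length≤3 wk (shortest _ (proj₁ via-S)) cf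
      where
      via-S : IsShortestPath G (⊤ ─ C) w₁ w₂ (w₁ ∷ x ∷ w₂ ∷ [])
      via-S = path-via-S D₁∈𝒞 D₂∈𝒞 D₁≢D₂ w₁∈D₁ w₂∈D₂ x∈S
                (other-clique⊆V─C D₁∈𝒞 D₁≢C w₁∈D₁) (S⊆V─C x∈S) (other-clique⊆V─C D₂∈𝒞 D₂≢C w₂∈D₂)

      length≤3 : ∀ {p} → Walk G (⊤ ─ C) w₁ w₂ p → length p ≤ 3 → ConflictFree G c p → ⊥
      length≤3 (single _) _ _ = disjoint D₁∈𝒞 D₂∈𝒞 D₁≢D₂ w₁∈D₁ w₂∈D₂
      length≤3 (step _ w₁w₂ (single _)) _ _ = nonadjacent D₁∈𝒞 D₂∈𝒞 D₁≢D₂ w₁∈D₁ w₂∈D₂ w₁w₂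
      length≤3 (step {w = y} _ w₁y (step _ yw₂ (single _))) _ cf with Clique.neighbour D₁∈𝒞 w₁∈D₁ w₁y
      ... | inj₁ y∈D₁ = nonadjacent D₁∈𝒞 D₂∈𝒞 D₁≢D₂ y∈D₁ w₂∈D₂ yw₂
      ... | inj₂ y∈S = ¬once-triple {i = c x}
        (subst₂ (λ i j → OccursOnce (i ∷ j ∷ c x ∷ [])) cw₁≡cx (S-mono y∈S)
          (subst (λ l → OccursOnce (c w₁ ∷ c y ∷ l ∷ [])) cw₂≡cx (to (conflictFree⇔ G c (w₁ ∷ y ∷ w₂ ∷ [])) cf)))
      length≤3 (step _ _ (step _ _ (step _ _ (single _)))) (s≤s (s≤s (s≤s ()))) _
      length≤3 (step _ _ (step _ _ (step _ _ (step _ _ _)))) (s≤s (s≤s (s≤s ()))) _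

    -- If S is monochromatic, not both D₁ and D₂ contain its colour: two such vertices would be
    -- joined only by the monochromatic shortest paths w₁ x w₂ with x ∈ S.
    separated-clique : ∀ {D₁ D₂ x₀} → x₀ ∈ S → 𝒞 D₁ → 𝒞 D₂ → D₁ ≢ C → D₂ ≢ C → D₁ ≢ D₂ →
                       SeparatedByS c D₁ ⊎ SeparatedByS c D₂
    separated-clique {D₁} {D₂} {x₀} x₀∈S D₁∈𝒞 D₂∈𝒞 D₁≢C D₂≢C D₁≢D₂
      with Fin.any? (λ x → x ∈? S ×-dec ¬? (c x ≟ c x₀))
    ... | yes (x₁ , x₁∈S , cx₁≢cx₀) = inj₁ λ {v} _ → witness (c v ≟ c x₀)
      where
      witness : ∀ {v} → Dec (c v ≡ c x₀) → ∃ λ x → x ∈ S × c x ≢ c v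
      witness (yes cv≡cx₀) = x₁ , x₁∈S , λ cx₁≡cv → cx₁≢cx₀ (trans cx₁≡cv cv≡cx₀)
      witness (no cv≢cx₀) = x₀ , x₀∈S , cv≢cx₀ ∘ sym
    ... | no ¬bichromatic with Fin.any? (λ w → w ∈? D₁ ×-dec (c w ≟ c x₀))
    ...   | no ¬D₁-hits = inj₁ λ {v} v∈D₁ → x₀ , x₀∈S , λ cx₀≡cv → ¬D₁-hits (v , v∈D₁ , sym cx₀≡cv)
    ...   | yes (w₁ , w₁∈D₁ , cw₁≡cx₀) = inj₂ λ {v} v∈D₂ → x₀ , x₀∈S , λ cx₀≡cv →
            ¬monochromatic-via-S D₁∈𝒞 D₂∈𝒞 D₁≢C D₂≢C D₁≢D₂ w₁∈D₁ v∈D₂ x₀∈S S-mono cw₁≡cx₀ (sym cx₀≡cv)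
      where
      S-mono : ∀ {y} → y ∈ S → c y ≡ c x₀
      S-mono {y} y∈S with c y ≟ c x₀
      ... | yes cy≡cx₀ = cy≡cx₀
      ... | no cy≢cx₀ = contradiction (y , y∈S , cy≢cx₀) ¬bichromatic

  S-nonempty : Connected G ⊤ → 𝒞 D → D ≢ C → Nonempty S
  S-nonempty connected D∈𝒞 D≢C
    with a , a∈C ← proj₁ (proj₂ (proj₁ C∈𝒞))
       | w , w∈D ← proj₁ (proj₂ (proj₁ D∈𝒞))
    with _ , (wk , _) ← connected a w ∈⊤ ∈⊤
    = Clique.leaving⇒S-nonempty C∈𝒞 wk a∈C (disjoint D∈𝒞 C∈𝒞 D≢C w∈D)

-- Strong colourings of G and of G − C

module _ {n : ℕ} {G : Graph n} {X : Subset n} (tc : TwinCover G ⊤ X) {S : Subset n} {s : ℕ} where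

  open TwinCoverFacts {G = G} {X = X} tc

  private
    𝒞 = InCSs G ⊤ X S s
    variable
      C D : Subset n
      a b u v w : Fin n
      p : List (Fin n)

  swap-hom : ∀ {σ} → 𝒞 C → 𝒞 D → C ≢ D → Swap C D σ → Adj G a b → Adj G (σ a) (σ b)
  swap-hom {C} {D} {a} {b} {σ} C∈𝒞 D∈𝒞 C≢D sw ab = by-position (position a) (position b) ab
    where
    open Swap sw

    position : ∀ x → x ∈ C ⊎ x ∈ D ⊎ (x ∉ C × x ∉ D)
    position x with x ∈? C | x ∈? D
    ... | yes x∈C | _ = inj₁ x∈C
    ... | no _ | yes x∈D = inj₂ (inj₁ x∈D)
    ... | no x∉C | no x∉D = inj₂ (inj₂ (x∉C , x∉D))

    clique-mates : ∀ {K K′ a b} → 𝒞 K′ → (∀ {x} → x ∈ K → σ x ∈ K′) → a ∈ K → b ∈ K → Adj G a b → Adj G (σ a) (σ b)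
    clique-mates K′∈𝒞 K→K′ a∈K b∈K ab =
      Clique.adjacent K′∈𝒞 (K→K′ a∈K) (K→K′ b∈K) (Adj⇒≢ G ab ∘ involutive⇒injective involutive)

    fixed-neighbour : ∀ {K K′ a b} → 𝒞 K → 𝒞 K′ → (∀ {x} → x ∈ K → σ x ∈ K′) →
                      a ∈ K → b ∉ K → b ∉ C → b ∉ D → Adj G a b → Adj G (σ a) (σ b)
    fixed-neighbour {b = b} K∈𝒞 K′∈𝒞 K→K′ a∈K b∉K b∉C b∉D ab = subst (Adj G _) (sym (fixes b∉C b∉D))
      (Clique.adjacent-S K′∈𝒞 (K→K′ a∈K) (Clique.exit∈S K∈𝒞 a∈K b∉K ab))

    by-position : ∀ {a b} → a ∈ C ⊎ a ∈ D ⊎ (a ∉ C × a ∉ D) → b ∈ C ⊎ b ∈ D ⊎ (b ∉ C × b ∉ D) →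
                  Adj G a b → Adj G (σ a) (σ b)
    by-position (inj₁ a∈C) (inj₁ b∈C) ab = clique-mates D∈𝒞 A→B a∈C b∈C ab
    by-position (inj₁ a∈C) (inj₂ (inj₁ b∈D)) ab = contradiction ab (nonadjacent C∈𝒞 D∈𝒞 C≢D a∈C b∈D)
    by-position (inj₁ a∈C) (inj₂ (inj₂ (b∉C , b∉D))) ab = fixed-neighbour C∈𝒞 D∈𝒞 A→B a∈C b∉C b∉C b∉D ab
    by-position (inj₂ (inj₁ a∈D)) (inj₁ b∈C) ab = contradiction ab (nonadjacent D∈𝒞 C∈𝒞 (C≢D ∘ sym) a∈D b∈C)
    by-position (inj₂ (inj₁ a∈D)) (inj₂ (inj₁ b∈D)) ab = clique-mates C∈𝒞 B→A a∈D b∈D ab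
    by-position (inj₂ (inj₁ a∈D)) (inj₂ (inj₂ (b∉C , b∉D))) ab = fixed-neighbour D∈𝒞 C∈𝒞 B→A a∈D b∉D b∉C b∉D ab
    by-position (inj₂ (inj₂ (a∉C , a∉D))) (inj₁ b∈C) ab =
      Adj-sym G (fixed-neighbour C∈𝒞 D∈𝒞 A→B b∈C a∉C a∉C a∉D (Adj-sym G ab))
    by-position (inj₂ (inj₂ (a∉C , a∉D))) (inj₂ (inj₁ b∈D)) ab =
      Adj-sym G (fixed-neighbour D∈𝒞 C∈𝒞 B→A b∈D a∉D a∉C a∉D (Adj-sym G ab))
    by-position (inj₂ (inj₂ (a∉C , a∉D))) (inj₂ (inj₂ (b∉C , b∉D))) ab =
      subst₂ (Adj G) (sym (fixes a∉C a∉D)) (sym (fixes b∉C b∉D)) ab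

  module _ {k} {c : Fin n → Fin k} (sc : StrongCFVC G ⊤ c) where

    injective-on-clique : 𝒞 D → a ∈ D → b ∈ D → c a ≡ c b → a ≡ b
    injective-on-clique {a = a} {b} D∈𝒞 a∈D b∈D ca≡cb with a ≟ b
    ... | yes a≡b = a≡b
    ... | no a≢b = contradiction ca≡cb (strong⇒proper G sc ∈⊤ ∈⊤ (Clique.adjacent D∈𝒞 a∈D b∈D a≢b))

    ∣image∣≡s : 𝒞 D → ∣ image c D ∣ ≡ s
    ∣image∣≡s D∈𝒞 = trans (∣image∣≡∣p∣ c (injective-on-clique D∈𝒞)) (proj₂ (proj₂ D∈𝒞))

    module Reroute (C∈𝒞 : 𝒞 C) (D∈𝒞 : 𝒞 D) (D≢C : D ≢ C) (same-colours : image c C ≡ image c D) where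

      partner : w ∈ C → ∃ λ d → d ∈ D × c d ≡ c w
      partner {w} w∈C = ∈-image⁻ {p = D} c (subst (c w ∈_) same-colours (∈-image⁺ c w∈C))

      τ : Fin n → Fin n
      τ w with w ∈? C
      ... | yes w∈C = proj₁ (partner w∈C)
      ... | no _ = w

      τ-∈ : w ∈ C → τ w ∈ D × c (τ w) ≡ c w
      τ-∈ {w} w∈C with w ∈? C
      ... | yes w∈C = proj₂ (partner w∈C)
      ... | no w∉C = contradiction w∈C w∉C

      τ-∉ : w ∉ C → τ w ≡ w
      τ-∉ {w} w∉C with w ∈? C
      ... | yes w∈C = contradiction w∈C w∉C
      ... | no _ = refl

      τ-colour : ∀ w → c (τ w) ≡ c w
      τ-colour w with w ∈? C
      ... | yes w∈C = proj₂ (proj₂ (partner w∈C))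
      ... | no _ = refl

      τ∉C : ∀ w → τ w ∉ C
      τ∉C w with w ∈? C
      ... | yes w∈C = disjoint D∈𝒞 C∈𝒞 D≢C (proj₁ (proj₂ (partner w∈C)))
      ... | no w∉C = w∉C

      τ-hom : Adj G a b → Adj G (τ a) (τ b)
      τ-hom {a} {b} ab = by-cases (a ∈? C) (b ∈? C)
        where
        from-C : ∀ {a b} → a ∈ C → b ∉ C → Adj G a b → Adj G (τ a) (τ b)
        from-C a∈C b∉C ab = subst (Adj G _) (sym (τ-∉ b∉C))
          (Clique.adjacent-S D∈𝒞 (proj₁ (τ-∈ a∈C)) (Clique.exit∈S C∈𝒞 a∈C b∉C ab))

        by-cases : Dec (a ∈ C) → Dec (b ∈ C) → Adj G (τ a) (τ b)
        by-cases (yes a∈C) (yes b∈C) = Clique.adjacent D∈𝒞 (proj₁ (τ-∈ a∈C)) (proj₁ (τ-∈ b∈C)) λ τa≡τb →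
          Adj⇒≢ G ab (injective-on-clique C∈𝒞 a∈C b∈C (trans (sym (τ-colour a)) (trans (cong c τa≡τb) (τ-colour b))))
        by-cases (yes a∈C) (no b∉C) = from-C a∈C b∉C ab
        by-cases (no a∉C) (yes b∈C) = Adj-sym G (from-C b∈C a∉C (Adj-sym G ab))
        by-cases (no a∉C) (no b∉C) = subst₂ (Adj G) (sym (τ-∉ a∉C)) (sym (τ-∉ b∉C)) ab

      reroute : u ∉ C → v ∉ C → IsShortestPath G ⊤ u v p → ConflictFree G c p → All (_∉ D) p →
                ∃ λ p′ → IsShortestPath G (⊤ ─ C) u v p′ × ConflictFree G c p′
      reroute {u} {v} {p} u∉C v∉C (path , shortest) cf p∩D≡∅ =
        map τ p , (path′ , shortest′) , conflictFree-resp G {p = p} {q = map τ p} recolour cf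
        where
        τ-injective-on-p : ∀ {x y} → x ∈ₗ p → y ∈ₗ p → τ x ≡ τ y → x ≡ y
        τ-injective-on-p {x} {y} x∈p y∈p τx≡τy = by-cases (x ∈? C) (y ∈? C)
          where
          by-cases : Dec (x ∈ C) → Dec (y ∈ C) → x ≡ y
          by-cases (yes x∈C) (yes y∈C) =
            injective-on-clique C∈𝒞 x∈C y∈C (trans (sym (τ-colour x)) (trans (cong c τx≡τy) (τ-colour y)))
          by-cases (yes x∈C) (no y∉C) =
            contradiction (subst (_∈ D) (trans τx≡τy (τ-∉ y∉C)) (proj₁ (τ-∈ x∈C))) (All.lookup p∩D≡∅ y∈p)
          by-cases (no x∉C) (yes y∈C) =
            contradiction (subst (_∈ D) (trans (sym τx≡τy) (τ-∉ x∉C)) (proj₁ (τ-∈ y∈C))) (All.lookup p∩D≡∅ x∈p)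
          by-cases (no x∉C) (no y∉C) = trans (sym (τ-∉ x∉C)) (trans τx≡τy (τ-∉ y∉C))

        path′ : IsPath G (⊤ ─ C) u v (map τ p)
        path′ = subst₂ (λ a b → IsPath G (⊤ ─ C) a b (map τ p)) (τ-∉ u∉C) (τ-∉ v∉C)
                  (path-map G τ-hom τ-injective-on-p (All.tabulate (λ {x} _ → ∉⇒∈⊤─ (τ∉C x))) path)

        shortest′ : ∀ q → IsPath G (⊤ ─ C) u v q → length (map τ p) ≤ length q
        shortest′ q path-q = subst (_≤ length q) (sym (length-map τ p)) (shortest q (path-⊤ G path-q))

        recolour : map c p ≡ map c (map τ p)
        recolour = trans (sym (map-cong τ-colour p)) (map-∘ p)

    -- A shortest path through C meets at most |X| + 1 twin-cliques, so it misses one of the cliques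
    -- coloured like C and can be rerouted through it.
    restriction-strong : 𝒞 C → ∀ {Ds} → Unique (C ∷ Ds) → All (λ D → 𝒞 D × image c C ≡ image c D) Ds →
                         suc ∣ X ∣ ≤ length Ds → StrongCFVC G (⊤ ─ C) c
    restriction-strong {C} C∈𝒞 {Ds} (C∉Ds ∷ Ds-unique) Ds-ok t<|Ds| u v u∈V─C v∈V─C u≢v
      with p , sp , cf ← sc u v ∈⊤ ∈⊤ u≢v
      with any? (_∈? C) p
    ... | no p∩C≡∅ = p , (path-restrict G (All.map ∉⇒∈⊤─ (¬Any⇒All¬ p p∩C≡∅)) (proj₁ sp) ,
                          λ q path → proj₂ sp q (path-⊤ G path)) , cf
    ... | yes p-meets-C with all? (λ D → any? (_∈? D) p) Ds
    ...   | no ¬all-met with D , D∈Ds , ¬D-met ← find (¬All⇒Any¬ (λ D → any? (_∈? D) p) Ds ¬all-met) =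
      Reroute.reroute C∈𝒞 (proj₁ (All.lookup Ds-ok D∈Ds)) (λ D≡C → All.lookup C∉Ds D∈Ds (sym D≡C))
        (proj₂ (All.lookup Ds-ok D∈Ds)) (x∈p─q⇒x∉q u∈V─C) (x∈p─q⇒x∉q v∈V─C) sp cf (¬Any⇒All¬ p ¬D-met)
    ...   | yes all-met =
      contradiction (≤-trans (s≤s t<|Ds|) (≤-trans cliques≤outsiders outsiders≤1+t)) (<-irrefl refl)
      where
      in-𝒞 : ∀ {D} → D ∈ₗ C ∷ Ds → 𝒞 D
      in-𝒞 (here refl) = C∈𝒞
      in-𝒞 (there D∈Ds) = proj₁ (All.lookup Ds-ok D∈Ds)

      met : ∀ {D} → D ∈ₗ C ∷ Ds → Any (_∈ D) p
      met (here refl) = p-meets-C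
      met (there D∈Ds) = All.lookup all-met D∈Ds

      outsiders : List (Fin n)
      outsiders = filter (∁? (_∈? X)) p

      hits-outsiders : ∀ {D} → D ∈ₗ C ∷ Ds → Any (_∈ D) outsiders
      hits-outsiders D∈ with x , x∈p , x∈D ← find (met D∈) =
        lose (∈-filter⁺ (∁? (_∈? X)) x∈p (Clique.∉X (in-𝒞 D∈) x∈D)) x∈D

      cliques≤outsiders : length (C ∷ Ds) ≤ length outsiders
      cliques≤outsiders = hitting-length-≤ (λ D x → x ∈ D) (C∉Ds ∷ Ds-unique)
        (λ D∈ D′∈ x∈D x∈D′ → shared-vertex⇒≡ (in-𝒞 D∈) (in-𝒞 D′∈) x∈D x∈D′) (All.tabulate hits-outsiders)

      3≤|p| : 3 ≤ length p
      3≤|p| with w , w∈p , w∈C ← find p-meets-C = unique-length-≤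
        (unique-∷ (λ { (here u≡w) → x∈p─q⇒x∉q u∈V─C (subst (_∈ C) (sym u≡w) w∈C)
                     ; (there (here u≡v)) → u≢v u≡v
                     ; (there (there ())) })
          (unique-∷ (λ { (here w≡v) → x∈p─q⇒x∉q v∈V─C (subst (_∈ C) w≡v w∈C) ; (there ()) }) ([] ∷ [])))
        λ { (here refl) → first∈walk G (proj₁ (proj₁ sp)) ; (there (here refl)) → w∈p
          ; (there (there (here refl))) → last∈walk G (proj₁ (proj₁ sp)) }

      outsiders≤1+t : length outsiders ≤ suc ∣ X ∣
      outsiders≤1+t = shortestPath-length-filter-∉ sp 3≤|p|

  svcfc≤-removal-independent : ∀ {k C C′} → 𝒞 C → 𝒞 C′ → svcfc≤ G (⊤ ─ C′) k → svcfc≤ G (⊤ ─ C) k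
  svcfc≤-removal-independent {C = C} {C′} C∈𝒞 C′∈𝒞 (c , sc) with C ≟ₛ C′
  ... | yes refl = c , sc
  ... | no C≢C′ = via-swap (swap C∩C′≡∅ (trans (proj₂ (proj₂ C∈𝒞)) (sym (proj₂ (proj₂ C′∈𝒞)))))
    where
    C∩C′≡∅ : ∀ {x} → x ∈ C → x ∉ C′
    C∩C′≡∅ = disjoint C∈𝒞 C′∈𝒞 C≢C′

    via-swap : ∃ (Swap C C′) → svcfc≤ G (⊤ ─ C) _
    via-swap (σ , sw) = c ∘ σ , strong-transport G (Swap.involutive sw) (swap-hom C∈𝒞 C′∈𝒞 C≢C′ sw)
      (∉⇒∈⊤─ ∘ swap-∉ sw C∩C′≡∅ ∘ x∈p─q⇒x∉q)
      (∉⇒∈⊤─ ∘ swap-∉ (swap-sym sw) (λ x∈C′ x∈C → C∩C′≡∅ x∈C x∈C′) ∘ x∈p─q⇒x∉q) sc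

  svcfc≤-restore : ∀ {k C D₁ D₂ x₀} → 𝒞 C → 𝒞 D₁ → 𝒞 D₂ → D₁ ≢ C → D₂ ≢ C → D₁ ≢ D₂ → x₀ ∈ S →
                    svcfc≤ G (⊤ ─ C) k → svcfc≤ G ⊤ k
  svcfc≤-restore {C = C} C∈𝒞 D₁∈𝒞 D₂∈𝒞 D₁≢C D₂≢C D₁≢D₂ x₀∈S (c , sc) =
    [ extend-via D₁∈𝒞 D₁≢C , extend-via D₂∈𝒞 D₂≢C ] (separated-clique tc C∈𝒞 sc x₀∈S D₁∈𝒞 D₂∈𝒞 D₁≢C D₂≢C D₁≢D₂)
    where
    extend-via : ∀ {D} → 𝒞 D → D ≢ C → SeparatedByS tc C∈𝒞 c D → svcfc≤ G ⊤ _
    extend-via D∈𝒞 D≢C separated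
      with σ , sw ← swap (disjoint C∈𝒞 D∈𝒞 (D≢C ∘ sym)) (trans (proj₂ (proj₂ C∈𝒞)) (sym (proj₂ (proj₂ D∈𝒞))))
      = extension , extension-strong
      where open Extension tc C∈𝒞 sc D∈𝒞 D≢C separated sw

  svcfc≤-remove : ∀ {k C} {Cs : List (Subset n)} → 𝒞 C → Unique Cs → All 𝒞 Cs →
                  suc ∣ X ∣ * length (subsetsOfSize k s) < length Cs → svcfc≤ G ⊤ k → svcfc≤ G (⊤ ─ C) k
  svcfc≤-remove {k} {C} {Cs} C∈𝒞 Cs-unique Cs⊆𝒞 many-cliques (c , sc) =
    let A , many = pigeonhole _≟ₛ_ (image c) (suc ∣ X ∣) (subsetsOfSize k s) Cs colour-sets-of-size-s many-cliques
    in from-colour-class (filter⁺ (λ D → image c D ≟ₛ A) Cs-unique) (All.tabulate (class-member A)) many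
    where
    colour-sets-of-size-s : All (λ D → image c D ∈ₗ subsetsOfSize k s) Cs
    colour-sets-of-size-s =
      All.map (λ D∈𝒞 → subst (λ m → _ ∈ₗ subsetsOfSize k m) (∣image∣≡s sc D∈𝒞) (∈-subsetsOfSize _)) Cs⊆𝒞

    class-member : ∀ A {D} → D ∈ₗ filter (λ D → image c D ≟ₛ A) Cs → 𝒞 D × image c D ≡ A
    class-member A D∈class = let D∈Cs , D-coloured-A = ∈-filter⁻ (λ D → image c D ≟ₛ A) D∈class in
      All.lookup Cs⊆𝒞 D∈Cs , D-coloured-A

    from-colour-class : ∀ {A Ds} → Unique Ds → All (λ D → 𝒞 D × image c D ≡ A) Ds → suc ∣ X ∣ < length Ds →
                        svcfc≤ G (⊤ ─ C) k
    from-colour-class {Ds = C′ ∷ Ds} Ds-unique ((C′∈𝒞 , C′-coloured-A) ∷ Ds-ok) (s≤s t<|Ds|) =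
      svcfc≤-removal-independent C∈𝒞 C′∈𝒞 (c , restriction-strong sc C′∈𝒞 Ds-unique
        (All.map (λ (D∈𝒞 , D-coloured-A) → D∈𝒞 , trans C′-coloured-A (sym D-coloured-A)) Ds-ok) t<|Ds|)

  twin-clique-reduction : ∀ {k C} {Cs : List (Subset n)} → Connected G ⊤ → s ≤ k → Unique Cs → All 𝒞 Cs →
    suc ∣ X ∣ * length (subsetsOfSize k s) < length Cs → 𝒞 C →
    Connected G (⊤ ─ C) × TwinCover G (⊤ ─ C) X × (svcfc≤ G ⊤ k ⇔ svcfc≤ G (⊤ ─ C) k)
  twin-clique-reduction {C = C} connected s≤k Cs-unique Cs⊆𝒞 many-cliques C∈𝒞
    with t<|Cs| ← m*n<l⇒m<l (subsetsOfSize-nonempty s≤k) many-cliques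
    with D , D∈Cs , D≢C ← unique⇒other _≟ₛ_ C Cs-unique (≤-trans (s≤s (s≤s z≤n)) t<|Cs|)
    with x₀ , x₀∈S ← S-nonempty tc C∈𝒞 connected (All.lookup Cs⊆𝒞 D∈Cs) D≢C
    with t≥1 ← ≤-trans (s≤s z≤n) (x∈p⇒∣p-x∣<∣p∣ (Clique.S⊆X C∈𝒞 x₀∈S))
    with D₁ , D₂ , D₁∈Cs , D₂∈Cs , D₁≢C , D₂≢C , D₁≢D₂ ←
           unique⇒two-others _≟ₛ_ C Cs-unique (≤-trans (s≤s (s≤s t≥1)) t<|Cs|)
    = removal-connected tc C∈𝒞 (All.lookup Cs⊆𝒞 D∈Cs) D≢C connected ,
      removal-twinCover tc C∈𝒞 ,
      mk⇔ (svcfc≤-remove C∈𝒞 Cs-unique Cs⊆𝒞 many-cliques)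
          (svcfc≤-restore C∈𝒞 (All.lookup Cs⊆𝒞 D₁∈Cs) (All.lookup Cs⊆𝒞 D₂∈Cs) D₁≢C D₂≢C D₁≢D₂ x₀∈S)

-- Imported only here: once _C_ is in scope, applications involving a variable named C parse ambiguously.
open import Data.Nat.Combinatorics using (_C_; nCk+nC[k+1]≡[n+1]C[k+1])

length-subsetsOfSize : ∀ k s → length (subsetsOfSize k s) ≡ k C s
length-subsetsOfSize zero zero = refl
length-subsetsOfSize zero (suc s) = refl
length-subsetsOfSize (suc k) zero = trans (length-map _ (subsetsOfSize k zero)) (length-subsetsOfSize k zero)
length-subsetsOfSize (suc k) (suc s) = begin
  length (map (outside ∷_) (subsetsOfSize k (suc s)) ++ map (inside ∷_) (subsetsOfSize k s))
    ≡⟨ length-++ (map (outside ∷_) (subsetsOfSize k (suc s))) ⟩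
  length (map (outside ∷_) (subsetsOfSize k (suc s))) + length (map (inside ∷_) (subsetsOfSize k s))
    ≡⟨ cong₂ _+_ (length-map _ (subsetsOfSize k (suc s))) (length-map _ (subsetsOfSize k s)) ⟩
  length (subsetsOfSize k (suc s)) + length (subsetsOfSize k s)
    ≡⟨ cong₂ _+_ (length-subsetsOfSize k (suc s)) (length-subsetsOfSize k s) ⟩
  k C suc s + k C s
    ≡⟨ +-comm (k C suc s) (k C s) ⟩
  k C s + k C suc s
    ≡⟨ nCk+nC[k+1]≡[n+1]C[k+1] k s ⟩
  suc k C suc s ∎
  where open ≡-Reasoning

lemma4 : (n : ℕ) (G : Graph n) → Connected G ⊤ →
    (k : ℕ) → 1 ≤ k →
    (X : Subset n) → TwinCover G ⊤ X →
    (S : Subset n) → S ⊆ X → (s : ℕ) → 1 ≤ s → s ≤ k →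
    (Cs : List (Subset n)) → Unique Cs → All (InCSs G ⊤ X S s) Cs →
    (suc ∣ X ∣ * (k C s)) < length Cs →
    (C : Subset n) → InCSs G ⊤ X S s C →
    Connected G (⊤ ─ C) × TwinCover G (⊤ ─ C) X
      × (svcfc≤ G ⊤ k ⇔ svcfc≤ G (⊤ ─ C) k)
lemma4 n G connected k _ X tc S _ s _ s≤k Cs Cs-unique Cs⊆𝒞 many-cliques _ C∈𝒞 =
  twin-clique-reduction tc connected s≤k Cs-unique Cs⊆𝒞
    (subst (λ m → suc ∣ X ∣ * m < length Cs) (sym (length-subsetsOfSize k s)) many-cliques) C∈𝒞
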